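{- For every integer $n\ge0$, $2^n\beta(\mathbf d^n)=E_{2n+1}$, where the Euler numbers $E_m$ are defined by $\tan x+\sec x=\sum_{m\ge0}E_m\,x^m/m!$.
   Context: For a graded poset $P$ of rank $r+1$ with $\hat0,\hat1$ and $S\subseteq[r]$, $f_S$ counts chains $\hat0<x_1<\dots<x_j<\hat1$ with rank set $S$, $h_S=\sum_{T\subseteq S}(-1)^{|S-T|}f_T$, and the ab-index is $\sum_S h_S u_1\cdots u_r$ with $u_i=\mathbf b$ if $i\in S$, $\mathbf a$ otherwise. For Eulerian $P$ it is uniquely a polynomial $\Psi(P)$ in the non-commuting variables $\mathbf c=\mathbf a+\mathbf b$ (degree 1), $\mathbf d=\mathbf a\mathbf b+\mathbf b\mathbf a$ (degree 2). $B_{r+1}$ is the Boolean lattice of subsets of $[r+1]$. For a word $v$ in $\mathbf c,\mathbf d$ of degree $r$, $\beta(v)$ is the coefficient of $v$ in $\Psi(B_{r+1})$ (so $\beta(\mathbf d^0)=\beta(1)=1$). -}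

module Defs where

open import Data.Bool using (Bool; true; false; if_then_else_; _xor_; _∧_; not)
open import Data.Nat as ℕ using (ℕ; zero; suc; _≡ᵇ_)
open import Data.Nat.Combinatorics using (_C_)
open import Data.Integer as ℤ using (ℤ; +_; -_; _-_)
open import Data.List using (List; []; _∷_; _++_; map; concatMap; foldr; length; upTo)
open import Data.Vec using (Vec; []; _∷_)

sumℤ : List ℤ → ℤ
sumℤ = foldr ℤ._+_ (+ 0)

sumℕ : List ℕ → ℕ
sumℕ = foldr ℕ._+_ 0

allVecs : (n : ℕ) → List (Vec Bool n)
allVecs zero    = [] ∷ []
allVecs (suc n) = concatMap (λ v → (false ∷ v) ∷ (true ∷ v) ∷ []) (allVecs n)

card : ∀ {n} → Vec Bool n → ℕ
card []           = 0
card (true  ∷ v) = suc (card v)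
card (false ∷ v) = card v

incl : ∀ {n} → Vec Bool n → Vec Bool n → Bool
incl []       []       = true
incl (x ∷ xs) (y ∷ ys) = (not x Data.Bool.∨ y) ∧ incl xs ys

-- The Boolean lattice B_m = subsets of [m] (as Vec Bool m), ordered by
-- inclusion, rank = cardinality.  A rank set S ⊆ [r] is a Vec Bool r
-- (position i, 0-based, stands for rank i+1).

ranksFrom : ℕ → ∀ {r} → Vec Bool r → List ℕ
ranksFrom k []           = []
ranksFrom k (true  ∷ s) = suc k ∷ ranksFrom (suc k) s
ranksFrom k (false ∷ s) = ranksFrom (suc k) s

ranks : ∀ {r} → Vec Bool r → List ℕ
ranks = ranksFrom 0

chainsFrom : (m : ℕ) → Vec Bool m → List ℕ → ℕ
chainsFrom m x []       = 1
chainsFrom m x (k ∷ ks) =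
  sumℕ (map (λ y → if incl x y ∧ (card y ≡ᵇ k) then chainsFrom m y ks else 0)
            (allVecs m))

bottom : (m : ℕ) → Vec Bool m
bottom zero    = []
bottom (suc m) = false ∷ bottom m

-- flag f-vector of B_{r+1}:  f_S = #chains 0̂ < x_1 < ... < x_j < 1̂
-- with rank set S ⊆ [r] (ranks ≤ r < r+1, so x_j < 1̂ automatically)
fB : (r : ℕ) → Vec Bool r → ℕ
fB r S = chainsFrom (suc r) (bottom (suc r)) (ranks S)

sign : ℕ → ℤ
sign zero          = + 1
sign (suc zero)    = - (+ 1)
sign (suc (suc k)) = sign k

hB : (r : ℕ) → Vec Bool r → ℤ
hB r S = sumℤ (map (λ T → if incl T S
                           then sign (card S ℕ.∸ card T) ℤ.* (+ fB r T)
                           else + 0)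
                   (allVecs r))

-- ab-index of B_{r+1}: coefficient of the ab-word u_1⋯u_r
-- (true = b, false = a) is h_S where S = {i : u_i = b}
abIndexB : (r : ℕ) → Vec Bool r → ℤ
abIndexB = hB

data CDWord : ℕ → Set where
  ε   : CDWord 0
  c∷_ : ∀ {n} → CDWord n → CDWord (suc n)
  d∷_ : ∀ {n} → CDWord n → CDWord (suc (suc n))

allCD : (n : ℕ) → List (CDWord n)
allCD zero          = ε ∷ []
allCD (suc zero)    = map c∷_ (allCD zero)
allCD (suc (suc n)) = map c∷_ (allCD (suc n)) ++ map d∷_ (allCD n)

-- coefficient of the ab-word w in the expansion of the cd-word v,
-- with c = a + b and d = ab + ba
expandWord : ∀ {n} → CDWord n → Vec Bool n → ℤ
expandWord ε         []           = + 1
expandWord (c∷ v)    (x ∷ w)      = expandWord v w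
expandWord (d∷ v)    (x ∷ y ∷ w) = if x xor y then expandWord v w else + 0

-- a cd-polynomial of degree n is its coefficient function on cd-words;
-- its ab-expansion:
expand : ∀ {n} → (CDWord n → ℤ) → Vec Bool n → ℤ
expand {n} ψ w = sumℤ (map (λ v → ψ v ℤ.* expandWord v w) (allCD n))

IsCDIndexB : (r : ℕ) → (CDWord r → ℤ) → Set
IsCDIndexB r ψ = ∀ (w : Vec Bool r) → expand ψ w Relation.Binary.PropositionalEquality.≡ abIndexB r w
  where import Relation.Binary.PropositionalEquality

double : ℕ → ℕ
double zero    = zero
double (suc n) = suc (suc (double n))

dPow : (n : ℕ) → CDWord (double n)
dPow zero    = ε
dPow (suc n) = d∷ (dPow n)

-- Euler numbers:  tan x + sec x = (1 + sin x)/cos x = Σ E_m x^m/m!.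
-- As exponential formal power series, F·cos = 1 + sin, i.e.
--   Σ_{k=0}^{m} C(m,k) E_k cosc_{m-k} = onePlusSin_m ,
-- where cosc_j, onePlusSin_j are the j-th derivatives at 0.
-- Since cosc_0 = 1 this determines E_m recursively.

cosc : ℕ → ℤ
cosc zero          = + 1
cosc (suc zero)    = + 0
cosc (suc (suc j)) = - cosc j

sinc : ℕ → ℤ
sinc zero          = + 0
sinc (suc zero)    = + 1
sinc (suc (suc j)) = - sinc j

onePlusSin : ℕ → ℤ
onePlusSin zero    = + 1
onePlusSin (suc j) = sinc (suc j)

nth : List ℤ → ℕ → ℤ
nth []       _       = + 0
nth (x ∷ xs) zero    = x
nth (x ∷ xs) (suc k) = nth xs k

-- eulers m = [E_0, …, E_{m-1}]
eulers : ℕ → List ℤ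
eulers zero    = []
eulers (suc m) = eulers m ++
  (onePlusSin m - sumℤ (map (λ k → (+ (m C k)) ℤ.* nth (eulers m) k ℤ.* cosc (m ℕ.∸ k))
                            (upTo m)))
  ∷ []

euler : ℕ → ℤ
euler m = nth (eulers (suc m)) m

-- Substituting a = 1 and b = -1 sends c to 0 and d to -2, so (-2)ⁿ β(dⁿ) is the
-- alternating sum τ_{2n+1} = Σ_S (-1)^|S| h_S of the flag h-vector of B_{2n+1}, whatever
-- cd-index is used. Counting chains in Boolean lattices gives a recursion for these sums
-- which says that their exponential generating function T satisfies
-- (e^{2x} + 1) T(x) = e^{2x} - 1, i.e. T = tanh x. As tan x = -i tanh(ix), the odd Euler
-- numbers are E_{2n+1} = (-1)ⁿ τ_{2n+1} = 2ⁿ β(dⁿ). A cd-index exists because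
-- Ψ(B_{m+1}) = c Ψ(B_m) + ∂ Ψ(B_m) for the derivation ∂ a = a b, ∂ b = b a, which maps
-- c to d and d to d c and so preserves cd-polynomials.

module Submission where

open import Defs
open import Data.Bool using (Bool; true; false; if_then_else_; _xor_; _∧_; not; T)
open import Data.Bool.Properties using (∧-zeroʳ; not-distribˡ-xor; not-involutive)
open import Data.Nat as ℕ using (ℕ; zero; suc; _≡ᵇ_; _≤_; _<_; z≤n; s≤s; _^_)
import Data.Nat.Properties as ℕᵖ
import Data.Nat.Tactic.RingSolver as ℕ-Solver
open import Data.Nat.Combinatorics using (_C_; nCk+nC[k+1]≡[n+1]C[k+1]; k>n⇒nCk≡0; nCn≡1)
open import Data.Integer as ℤ using (ℤ; +_; -_; _+_; _-_; _*_)
import Data.Integer.Properties as ℤᵖ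
open import Data.Integer.Tactic.RingSolver using (solve-∀; solve)
open import Data.List as List using (List; []; _∷_; _++_; map; concatMap; applyUpTo; upTo; length)
open import Data.List.Properties using (map-++; map-∘; map-upTo; applyUpTo-∷ʳ; length-++)
open import Data.Vec using (Vec; []; _∷_)
open import Data.Product using (Σ; _×_; _,_)
open import Data.Sum using (inj₁; inj₂)
open import Data.Nat.Induction using (<-rec)
open import Relation.Binary.PropositionalEquality
open ≡-Reasoning

record IsLinear {A : Set} (φ : (A → ℤ) → ℤ) : Set where
  field
    φ-cong   : ∀ {F H} → (∀ x → F x ≡ H x) → φ F ≡ φ H
    φ-linear : ∀ a b F H → φ (λ x → a * F x + b * H x) ≡ a * φ F + b * φ H

  φ-+ : ∀ F H → φ (λ x → F x + H x) ≡ φ F + φ H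
  φ-+ F H = begin
    φ (λ x → F x + H x)             ≡⟨ φ-cong (λ x → sym (cong₂ _+_ (ℤᵖ.*-identityˡ (F x)) (ℤᵖ.*-identityˡ (H x)))) ⟩
    φ (λ x → + 1 * F x + + 1 * H x) ≡⟨ φ-linear (+ 1) (+ 1) F H ⟩
    + 1 * φ F + + 1 * φ H           ≡⟨ cong₂ _+_ (ℤᵖ.*-identityˡ (φ F)) (ℤᵖ.*-identityˡ (φ H)) ⟩
    φ F + φ H                       ∎

  φ-* : ∀ k F → φ (λ x → k * F x) ≡ k * φ F
  φ-* k F = begin
    φ (λ x → k * F x)             ≡⟨ φ-cong (λ x → pad k (F x)) ⟩
    φ (λ x → k * F x + + 0 * F x) ≡⟨ φ-linear k (+ 0) F F ⟩
    k * φ F + + 0 * φ F           ≡⟨ sym (pad k (φ F)) ⟩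
    k * φ F                       ∎
    where pad : ∀ k y → k * y ≡ k * y + + 0 * y
          pad = solve-∀

  φ-0 : φ (λ _ → + 0) ≡ + 0
  φ-0 = begin
    φ (λ _ → + 0)       ≡⟨ φ-cong (λ _ → sym (ℤᵖ.*-zeroˡ (+ 0))) ⟩
    φ (λ _ → + 0 * + 0) ≡⟨ φ-* (+ 0) (λ _ → + 0) ⟩
    + 0 * φ (λ _ → + 0) ≡⟨ ℤᵖ.*-zeroˡ (φ (λ _ → + 0)) ⟩
    + 0                 ∎

  φ-− : ∀ F H → φ (λ x → F x - H x) ≡ φ F - φ H
  φ-− F H = begin
    φ (λ x → F x - H x)                ≡⟨ φ-cong (λ x → minus (F x) (H x)) ⟩
    φ (λ x → + 1 * F x + - + 1 * H x)  ≡⟨ φ-linear (+ 1) (- + 1) F H ⟩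
    + 1 * φ F + - + 1 * φ H            ≡⟨ sym (minus (φ F) (φ H)) ⟩
    φ F - φ H                          ∎
    where minus : ∀ y z → y - z ≡ + 1 * y + - + 1 * z
          minus = solve-∀

  φ-*- : ∀ k F H → φ (λ x → k * F x - H x) ≡ k * φ F - φ H
  φ-*- k F H = trans (φ-− (λ x → k * F x) H) (cong (_- φ H) (φ-* k F))

  φ-sumℤ : ∀ {B : Set} (L : List B) (h : B → A → ℤ) →
           φ (λ x → sumℤ (map (λ v → h v x) L)) ≡ sumℤ (map (λ v → φ (h v)) L)
  φ-sumℤ []      h = φ-0
  φ-sumℤ (v ∷ L) h = trans (φ-+ (h v) _) (cong (_+_ (φ (h v))) (φ-sumℤ L h))

open IsLinear

sumℤ-++ : ∀ (xs ys : List ℤ) → sumℤ (xs ++ ys) ≡ sumℤ xs + sumℤ ys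
sumℤ-++ []       ys = sym (ℤᵖ.+-identityˡ _)
sumℤ-++ (x ∷ xs) ys = trans (cong (_+_ x) (sumℤ-++ xs ys)) (sym (ℤᵖ.+-assoc x _ _))

sumℤ-isLinear : ∀ {A : Set} (L : List A) → IsLinear (λ f → sumℤ (map f L))
sumℤ-isLinear L = record { φ-cong = cong-sum L ; φ-linear = linear-sum L }
  where
  cong-sum : ∀ {A : Set} (L : List A) {f g : A → ℤ} → (∀ x → f x ≡ g x) → sumℤ (map f L) ≡ sumℤ (map g L)
  cong-sum []      e = refl
  cong-sum (x ∷ L) e = cong₂ _+_ (e x) (cong-sum L e)
  linear-sum : ∀ {A : Set} (L : List A) a b f g →
               sumℤ (map (λ x → a * f x + b * g x) L) ≡ a * sumℤ (map f L) + b * sumℤ (map g L)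
  linear-sum []      a b f g = zeros a b
    where zeros : ∀ a b → + 0 ≡ a * + 0 + b * + 0
          zeros = solve-∀
  linear-sum (x ∷ L) a b f g = trans (cong (_+_ (a * f x + b * g x)) (linear-sum L a b f g)) (regroup a b (f x) (g x) _ _)
    where regroup : ∀ a b y z s t → a * y + b * z + (a * s + b * t) ≡ a * (y + s) + b * (z + t)
          regroup = solve-∀

module Sumℤ {A : Set} (L : List A) = IsLinear (sumℤ-isLinear L)

module _ {A : Set} where

  eval-isLinear : (x : A) → IsLinear (λ (F : A → ℤ) → F x)
  eval-isLinear x = record { φ-cong = λ e → e x ; φ-linear = λ _ _ _ _ → refl }

  zero-isLinear : IsLinear (λ (_ : A → ℤ) → + 0)
  zero-isLinear = record { φ-cong = λ _ → refl ; φ-linear = λ a b _ _ → zeros a b }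
    where zeros : ∀ a b → + 0 ≡ a * + 0 + b * + 0
          zeros = solve-∀

  +-isLinear : ∀ {φ ψ : (A → ℤ) → ℤ} → IsLinear φ → IsLinear ψ → IsLinear (λ F → φ F + ψ F)
  +-isLinear lφ lψ = record
    { φ-cong   = λ e → cong₂ _+_ (φ-cong lφ e) (φ-cong lψ e)
    ; φ-linear = λ a b F H → trans (cong₂ _+_ (φ-linear lφ a b F H) (φ-linear lψ a b F H)) (regroup a b _ _ _ _)
    }
    where regroup : ∀ a b x y z t → a * x + b * y + (a * z + b * t) ≡ a * (x + z) + b * (y + t)
          regroup = solve-∀

  −-isLinear : ∀ {φ ψ : (A → ℤ) → ℤ} → IsLinear φ → IsLinear ψ → IsLinear (λ F → φ F - ψ F)
  −-isLinear lφ lψ = record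
    { φ-cong   = λ e → cong₂ _-_ (φ-cong lφ e) (φ-cong lψ e)
    ; φ-linear = λ a b F H → trans (cong₂ _-_ (φ-linear lφ a b F H) (φ-linear lψ a b F H)) (regroup a b _ _ _ _)
    }
    where regroup : ∀ a b x y z t → a * x + b * y - (a * z + b * t) ≡ a * (x - z) + b * (y - t)
          regroup = solve-∀

  weighted-isLinear : ∀ {φ : (A → ℤ) → ℤ} (c : A → ℤ) → IsLinear φ → IsLinear (λ F → φ (λ x → F x * c x))
  weighted-isLinear c lφ = record
    { φ-cong   = λ e → φ-cong lφ (λ x → cong (_* c x) (e x))
    ; φ-linear = λ a b F H → trans (φ-cong lφ (λ x → distrib a b (F x) (H x) (c x)))
                                   (φ-linear lφ a b (λ x → F x * c x) (λ x → H x * c x))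
    }
    where distrib : ∀ a b y z t → (a * y + b * z) * t ≡ a * (y * t) + b * (z * t)
          distrib = solve-∀

precomp-isLinear : ∀ {A B : Set} {φ : (A → ℤ) → ℤ} (g : A → B) → IsLinear φ → IsLinear (λ (F : B → ℤ) → φ (λ x → F (g x)))
precomp-isLinear g lφ = record
  { φ-cong   = λ e → φ-cong lφ (λ x → e (g x))
  ; φ-linear = λ a b F H → φ-linear lφ a b (λ x → F (g x)) (λ x → H (g x))
  }

isLinear-≗ : ∀ {A : Set} {φ ψ : (A → ℤ) → ℤ} → (∀ F → φ F ≡ ψ F) → IsLinear φ → IsLinear ψ
isLinear-≗ {φ = φ} {ψ} e lφ = record
  { φ-cong   = λ {F} {H} eq → trans (sym (e F)) (trans (φ-cong lφ eq) (e H))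
  ; φ-linear = λ a b F H → trans (sym (e _)) (trans (φ-linear lφ a b F H) (cong₂ (λ x y → a * x + b * y) (e F) (e H)))
  }

ABPoly : ℕ → Set
ABPoly n = Vec Bool n → ℤ

a· b· c· : ∀ {n} → ABPoly n → ABPoly (suc n)
a· F (false ∷ w) = F w
a· F (true  ∷ w) = + 0
b· F (false ∷ w) = + 0
b· F (true  ∷ w) = F w
c· F (_     ∷ w) = F w

d· : ∀ {n} → ABPoly n → ABPoly (suc (suc n))
d· F (x ∷ y ∷ w) = if x xor y then F w else + 0

-- The derivation with ∂ a = a b and ∂ b = b a.
∂ : ∀ {n} → ABPoly n → ABPoly (suc n)
∂ {zero}  F w           = + 0
∂ {suc n} F (false ∷ w) = b· (λ v → F (false ∷ v)) w + ∂ (λ v → F (false ∷ v)) w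
∂ {suc n} F (true  ∷ w) = a· (λ v → F (true ∷ v)) w + ∂ (λ v → F (true ∷ v)) w

module _ {n : ℕ} where

  a·-isLinear : (w : Vec Bool (suc n)) → IsLinear (λ (F : ABPoly n) → a· F w)
  a·-isLinear (false ∷ w) = eval-isLinear w
  a·-isLinear (true  ∷ w) = zero-isLinear

  b·-isLinear : (w : Vec Bool (suc n)) → IsLinear (λ (F : ABPoly n) → b· F w)
  b·-isLinear (false ∷ w) = zero-isLinear
  b·-isLinear (true  ∷ w) = eval-isLinear w

  c·-isLinear : (w : Vec Bool (suc n)) → IsLinear (λ (F : ABPoly n) → c· F w)
  c·-isLinear (_ ∷ w) = eval-isLinear w

  d·-isLinear : (w : Vec Bool (suc (suc n))) → IsLinear (λ (F : ABPoly n) → d· F w)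
  d·-isLinear (x ∷ y ∷ w) with x xor y
  ... | true  = eval-isLinear w
  ... | false = zero-isLinear

∂-isLinear : ∀ {n} (w : Vec Bool (suc n)) → IsLinear (λ (F : ABPoly n) → ∂ F w)
∂-isLinear {zero}  w           = zero-isLinear
∂-isLinear {suc n} (false ∷ w) = precomp-isLinear (false ∷_) (+-isLinear (b·-isLinear w) (∂-isLinear w))
∂-isLinear {suc n} (true  ∷ w) = precomp-isLinear (true ∷_) (+-isLinear (a·-isLinear w) (∂-isLinear w))

module _ {n : ℕ} (E : ABPoly n) where

  c·-split : ∀ w → c· E w ≡ a· E w + b· E w
  c·-split (false ∷ w) = sym (ℤᵖ.+-identityʳ _)
  c·-split (true  ∷ w) = sym (ℤᵖ.+-identityˡ _)

  d·-false : ∀ w → d· E (false ∷ w) ≡ b· E w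
  d·-false (false ∷ w) = refl
  d·-false (true  ∷ w) = refl

  d·-true : ∀ w → d· E (true ∷ w) ≡ a· E w
  d·-true (false ∷ w) = refl
  d·-true (true  ∷ w) = refl

module _ {n : ℕ} (E : ABPoly n) where

  ∂-a· : ∀ w → ∂ (a· E) w ≡ a· (b· E) w + a· (∂ E) w
  ∂-a· (false ∷ w) = refl
  ∂-a· (true  ∷ w) = cong₂ _+_ (φ-0 (a·-isLinear w)) (φ-0 (∂-isLinear w))

  ∂-b· : ∀ w → ∂ (b· E) w ≡ b· (a· E) w + b· (∂ E) w
  ∂-b· (false ∷ w) = cong₂ _+_ (φ-0 (b·-isLinear w)) (φ-0 (∂-isLinear w))
  ∂-b· (true  ∷ w) = refl

  ∂-c· : ∀ w → ∂ (c· E) w ≡ d· E w + c· (∂ E) w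
  ∂-c· (false ∷ w) = cong (_+ ∂ E w) (sym (d·-false E w))
  ∂-c· (true  ∷ w) = cong (_+ ∂ E w) (sym (d·-true E w))

  ∂-d· : ∀ w → ∂ (d· E) w ≡ d· (c· E) w + d· (∂ E) w
  ∂-d· (false ∷ w) = begin
    b· (λ v → d· E (false ∷ v)) w + ∂ (λ v → d· E (false ∷ v)) w
      ≡⟨ cong₂ _+_ (φ-cong (b·-isLinear w) (d·-false E)) (φ-cong (∂-isLinear w) (d·-false E)) ⟩
    b· (b· E) w + ∂ (b· E) w
      ≡⟨ cong (_+_ (b· (b· E) w)) (∂-b· w) ⟩
    b· (b· E) w + (b· (a· E) w + b· (∂ E) w)
      ≡⟨ regroup (b· (b· E) w) (b· (a· E) w) (b· (∂ E) w) ⟩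
    b· (a· E) w + b· (b· E) w + b· (∂ E) w
      ≡⟨ cong (_+ b· (∂ E) w) (sym (φ-+ (b·-isLinear w) (a· E) (b· E))) ⟩
    b· (λ v → a· E v + b· E v) w + b· (∂ E) w
      ≡⟨ cong (_+ b· (∂ E) w) (sym (φ-cong (b·-isLinear w) (c·-split E))) ⟩
    b· (c· E) w + b· (∂ E) w
      ≡⟨ sym (cong₂ _+_ (d·-false (c· E) w) (d·-false (∂ E) w)) ⟩
    d· (c· E) (false ∷ w) + d· (∂ E) (false ∷ w) ∎
    where regroup : ∀ x y z → x + (y + z) ≡ y + x + z
          regroup = solve-∀
  ∂-d· (true  ∷ w) = begin
    a· (λ v → d· E (true ∷ v)) w + ∂ (λ v → d· E (true ∷ v)) w
      ≡⟨ cong₂ _+_ (φ-cong (a·-isLinear w) (d·-true E)) (φ-cong (∂-isLinear w) (d·-true E)) ⟩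
    a· (a· E) w + ∂ (a· E) w
      ≡⟨ cong (_+_ (a· (a· E) w)) (∂-a· w) ⟩
    a· (a· E) w + (a· (b· E) w + a· (∂ E) w)
      ≡⟨ sym (ℤᵖ.+-assoc (a· (a· E) w) (a· (b· E) w) (a· (∂ E) w)) ⟩
    a· (a· E) w + a· (b· E) w + a· (∂ E) w
      ≡⟨ cong (_+ a· (∂ E) w) (sym (φ-+ (a·-isLinear w) (a· E) (b· E))) ⟩
    a· (λ v → a· E v + b· E v) w + a· (∂ E) w
      ≡⟨ cong (_+ a· (∂ E) w) (sym (φ-cong (a·-isLinear w) (c·-split E))) ⟩
    a· (c· E) w + a· (∂ E) w
      ≡⟨ sym (cong₂ _+_ (d·-true (c· E) w) (d·-true (∂ E) w)) ⟩
    d· (c· E) (true ∷ w) + d· (∂ E) (true ∷ w) ∎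

CDPoly : ℕ → Set
CDPoly n = CDWord n → ℤ

c·ᶜᵈ : ∀ {n} → CDPoly n → CDPoly (suc n)
c·ᶜᵈ ψ (c∷ v) = ψ v
c·ᶜᵈ ψ (d∷ v) = + 0

-- The derivation with ∂ c = d and ∂ d = d c, which ∂ induces on cd-polynomials.
∂ᶜᵈ : ∀ {n} → CDPoly n → CDPoly (suc n)
∂ᶜᵈ {zero}        ψ (c∷ ε) = + 0
∂ᶜᵈ {suc n}       ψ (c∷ v) = ∂ᶜᵈ (λ u → ψ (c∷ u)) v
∂ᶜᵈ {suc zero}    ψ (d∷ ε) = ψ (c∷ ε)
∂ᶜᵈ {suc (suc n)} ψ (d∷ v) = ψ (c∷ v) + c·ᶜᵈ (λ u → ψ (d∷ u)) v + ∂ᶜᵈ (λ u → ψ (d∷ u)) v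

expand-isLinear : ∀ {n} (w : Vec Bool n) → IsLinear (λ (ψ : CDPoly n) → expand ψ w)
expand-isLinear {n} w = weighted-isLinear (λ v → expandWord v w) (sumℤ-isLinear (allCD n))

expand-split : ∀ {n} (ψ : CDPoly (suc (suc n))) w →
               expand ψ w ≡ c· (expand (λ v → ψ (c∷ v))) w + d· (expand (λ v → ψ (d∷ v))) w
expand-split {n} ψ (x ∷ y ∷ w) = begin
  sumℤ (map term (map c∷_ (allCD (suc n)) ++ map d∷_ (allCD n)))
    ≡⟨ cong sumℤ (map-++ term (map c∷_ (allCD (suc n))) (map d∷_ (allCD n))) ⟩
  sumℤ (map term (map c∷_ (allCD (suc n))) ++ map term (map d∷_ (allCD n)))
    ≡⟨ sumℤ-++ (map term (map c∷_ (allCD (suc n)))) (map term (map d∷_ (allCD n))) ⟩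
  sumℤ (map term (map c∷_ (allCD (suc n)))) + sumℤ (map term (map d∷_ (allCD n)))
    ≡⟨ cong₂ _+_ (cong sumℤ (sym (map-∘ (allCD (suc n))))) (trans (cong sumℤ (sym (map-∘ (allCD n)))) (d-part (x xor y))) ⟩
  expand (λ v → ψ (c∷ v)) (y ∷ w) + (if x xor y then expand (λ v → ψ (d∷ v)) w else + 0) ∎
  where
  term : CDWord (suc (suc n)) → ℤ
  term v = ψ v * expandWord v (x ∷ y ∷ w)
  d-part : ∀ b → sumℤ (map (λ v → ψ (d∷ v) * (if b then expandWord v w else + 0)) (allCD n))
               ≡ (if b then expand (λ v → ψ (d∷ v)) w else + 0)
  d-part true  = refl
  d-part false = trans (Sumℤ.φ-cong (allCD n) (λ v → ℤᵖ.*-zeroʳ (ψ (d∷ v)))) (Sumℤ.φ-0 (allCD n))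

expand-c·ᶜᵈ : ∀ {n} (ψ : CDPoly n) w → expand (c·ᶜᵈ ψ) w ≡ c· (expand ψ) w
expand-c·ᶜᵈ {zero}  ψ (x ∷ []) = refl
expand-c·ᶜᵈ {suc n} ψ w@(_ ∷ _ ∷ _) = begin
  expand (c·ᶜᵈ ψ) w
    ≡⟨ expand-split (c·ᶜᵈ ψ) w ⟩
  c· (expand ψ) w + d· (expand {n} (λ _ → + 0)) w
    ≡⟨ cong (_+_ (c· (expand ψ) w)) (trans (φ-cong (d·-isLinear w) (λ v → φ-0 (expand-isLinear v))) (φ-0 (d·-isLinear w))) ⟩
  c· (expand ψ) w + + 0
    ≡⟨ ℤᵖ.+-identityʳ _ ⟩
  c· (expand ψ) w ∎

expand-∂ : ∀ {n} (ψ : CDPoly n) w → expand (∂ᶜᵈ ψ) w ≡ ∂ (expand ψ) w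
expand-∂ {zero}        ψ (x ∷ [])     = refl
expand-∂ {suc zero}    ψ w@(_ ∷ _ ∷ []) = begin
  expand (∂ᶜᵈ ψ) w         ≡⟨ expand-split (∂ᶜᵈ ψ) w ⟩
  + 0 + d· E₁ w            ≡⟨ ℤᵖ.+-identityˡ (d· E₁ w) ⟩
  d· E₁ w                  ≡⟨ sym (ℤᵖ.+-identityʳ (d· E₁ w)) ⟩
  d· E₁ w + c· (∂ E₁) w    ≡⟨ sym (∂-c· E₁ w) ⟩
  ∂ (c· E₁) w              ≡⟨ φ-cong (∂-isLinear w) (λ { (_ ∷ []) → refl }) ⟩
  ∂ (expand ψ) w           ∎
  where E₁ = expand (λ u → ψ (c∷ u))
expand-∂ {suc (suc m)} ψ w            = begin
  expand (∂ᶜᵈ ψ) w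
    ≡⟨ expand-split (∂ᶜᵈ ψ) w ⟩
  c· (expand (∂ᶜᵈ ψc)) w + d· (expand (λ v → ψc v + c·ᶜᵈ ψd v + ∂ᶜᵈ ψd v)) w
    ≡⟨ cong₂ _+_ (φ-cong (c·-isLinear w) (expand-∂ ψc)) (φ-cong (d·-isLinear w) expand-d-tail) ⟩
  c· (∂ E₁) w + d· (λ v → E₁ v + c· E₂ v + ∂ E₂ v) w
    ≡⟨ cong (_+_ (c· (∂ E₁) w)) d·-tail ⟩
  c· (∂ E₁) w + (d· E₁ w + d· (c· E₂) w + d· (∂ E₂) w)
    ≡⟨ regroup (c· (∂ E₁) w) (d· E₁ w) (d· (c· E₂) w) (d· (∂ E₂) w) ⟩
  (d· E₁ w + c· (∂ E₁) w) + (d· (c· E₂) w + d· (∂ E₂) w)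
    ≡⟨ sym (cong₂ _+_ (∂-c· E₁ w) (∂-d· E₂ w)) ⟩
  ∂ (c· E₁) w + ∂ (d· E₂) w
    ≡⟨ sym (φ-+ (∂-isLinear w) (c· E₁) (d· E₂)) ⟩
  ∂ (λ v → c· E₁ v + d· E₂ v) w
    ≡⟨ sym (φ-cong (∂-isLinear w) (expand-split ψ)) ⟩
  ∂ (expand ψ) w ∎
  where
  ψc : CDPoly (suc m)
  ψc u = ψ (c∷ u)
  ψd : CDPoly m
  ψd u = ψ (d∷ u)
  E₁ = expand ψc
  E₂ = expand ψd
  expand-d-tail : ∀ v → expand (λ u → ψc u + c·ᶜᵈ ψd u + ∂ᶜᵈ ψd u) v ≡ E₁ v + c· E₂ v + ∂ E₂ v
  expand-d-tail v = begin
    expand (λ u → ψc u + c·ᶜᵈ ψd u + ∂ᶜᵈ ψd u) v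
      ≡⟨ φ-+ (expand-isLinear v) (λ u → ψc u + c·ᶜᵈ ψd u) (∂ᶜᵈ ψd) ⟩
    expand (λ u → ψc u + c·ᶜᵈ ψd u) v + expand (∂ᶜᵈ ψd) v
      ≡⟨ cong₂ _+_ (trans (φ-+ (expand-isLinear v) ψc (c·ᶜᵈ ψd)) (cong (_+_ (E₁ v)) (expand-c·ᶜᵈ ψd v)))
                   (expand-∂ ψd v) ⟩
    E₁ v + c· E₂ v + ∂ E₂ v ∎
  d·-tail : d· (λ v → E₁ v + c· E₂ v + ∂ E₂ v) w ≡ d· E₁ w + d· (c· E₂) w + d· (∂ E₂) w
  d·-tail = trans (φ-+ (d·-isLinear w) (λ v → E₁ v + c· E₂ v) (∂ E₂))
                  (cong (_+ d· (∂ E₂) w) (φ-+ (d·-isLinear w) E₁ (c· E₂)))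
  regroup : ∀ p q r s → p + (q + r + s) ≡ q + p + (r + s)
  regroup = solve-∀

-- The ab-index recursion of the Boolean lattices

-- The number of ways to choose the next element of a chain g + 1 ranks
-- up, inside an interval of rank g + d + 2 of a Boolean lattice.
jump : ℕ → ℕ → ℕ
jump g d = suc (suc (g ℕ.+ d)) C suc g

jump-pascal : ∀ g d → jump (suc g) (suc d) ≡ jump g (suc d) ℕ.+ jump (suc g) d
jump-pascal g d = begin
  suc (suc (suc g ℕ.+ suc d)) C suc (suc g)
    ≡⟨ cong (λ n → suc (suc n) C suc (suc g)) (ℕᵖ.+-suc (suc g) d) ⟩
  suc (suc (suc (suc g ℕ.+ d))) C suc (suc g)
    ≡⟨ sym (nCk+nC[k+1]≡[n+1]C[k+1] (suc (suc (suc g ℕ.+ d))) (suc g)) ⟩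
  suc (suc (suc g ℕ.+ d)) C suc g ℕ.+ jump (suc g) d
    ≡⟨ cong (λ n → suc (suc n) C suc g ℕ.+ jump (suc g) d) (sym (ℕᵖ.+-suc g d)) ⟩
  jump g (suc d) ℕ.+ jump (suc g) d ∎

jump-pascal-top : ∀ g → jump (suc g) 0 ≡ jump g 0 ℕ.+ 1
jump-pascal-top g = begin
  suc (suc (suc (g ℕ.+ 0))) C suc (suc g)
    ≡⟨ sym (nCk+nC[k+1]≡[n+1]C[k+1] (suc (suc (g ℕ.+ 0))) (suc g)) ⟩
  jump g 0 ℕ.+ suc (suc (g ℕ.+ 0)) C suc (suc g)
    ≡⟨ cong (λ n → jump g 0 ℕ.+ suc (suc n) C suc (suc g)) (ℕᵖ.+-identityʳ g) ⟩
  jump g 0 ℕ.+ suc (suc g) C suc (suc g)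
    ≡⟨ cong (jump g 0 ℕ.+_) (nCn≡1 (suc (suc g))) ⟩
  jump g 0 ℕ.+ 1 ∎

jump-pascal-bottom : ∀ d → jump 0 (suc d) ≡ 1 ℕ.+ jump 0 d
jump-pascal-bottom d = sym (nCk+nC[k+1]≡[n+1]C[k+1] (suc (suc d)) 0)

-- flagHRec d 0 is the ab-index of B_{d+1}.
flagHRec : (d g : ℕ) → ABPoly d
flagHRec zero    g []          = + 1
flagHRec (suc d) g (false ∷ w) = flagHRec d (suc g) w
flagHRec (suc d) g (true  ∷ w) = + jump g d * flagHRec d 0 w - flagHRec d (suc g) w

flagHRec-split : ∀ d g w → flagHRec (suc d) g w
               ≡ a· (flagHRec d (suc g)) w + (+ jump g d * b· (flagHRec d 0) w - b· (flagHRec d (suc g)) w)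
flagHRec-split d g (false ∷ w) = padding (flagHRec d (suc g) w) (+ jump g d)
  where padding : ∀ y k → y ≡ y + (k * + 0 - + 0)
        padding = solve-∀
flagHRec-split d g (true  ∷ w) = sym (ℤᵖ.+-identityˡ _)

x≡y+z⇒z≡x-y : ∀ {y s t : ℤ} → y ≡ s + t → t ≡ y - s
x≡y+z⇒z≡x-y {s = s} {t} refl = cancel s t
  where cancel : ∀ s t → t ≡ s + t - s
        cancel = solve-∀

mutual
  flagHRec-∂ : ∀ d w → flagHRec (suc d) 0 w ≡ c· (flagHRec d 0) w + ∂ (flagHRec d 0) w
  flagHRec-∂ zero    (false ∷ []) = refl
  flagHRec-∂ zero    (true  ∷ []) = refl
  flagHRec-∂ (suc d) (false ∷ w)  = trans (flagHRec-gap d 0 w) (ℤᵖ.+-assoc (flagHRec (suc d) 0 w) _ _)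
  flagHRec-∂ (suc d) (true  ∷ w)  = begin
    + jump 0 (suc d) * Y₀ - Y₁
      ≡⟨ cong (λ n → + n * Y₀ - Y₁) (jump-pascal-bottom d) ⟩
    + (1 ℕ.+ jump 0 d) * Y₀ - Y₁
      ≡⟨ cong (λ z → z * Y₀ - Y₁) (ℤᵖ.pos-+ 1 (jump 0 d)) ⟩
    (+ 1 + k) * Y₀ - Y₁
      ≡⟨ combine k (a· H₀ w) (b· H₀ w) (a· H₁ w) (b· H₁ w) (∂ H₁ w) Y₀ Y₁ (∂ H₀ w)
                 (flagHRec-split d 0 w) ∂H₀ (flagHRec-gap d 0 w) ⟩
    Y₀ + ((k * a· H₀ w - a· H₁ w) + (k * ∂ H₀ w - ∂ H₁ w))
      ≡⟨ sym (cong (_+_ Y₀) (cong₂ _+_ (φ-*- (a·-isLinear w) k H₀ H₁) (φ-*- (∂-isLinear w) k H₀ H₁))) ⟩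
    c· (flagHRec (suc d) 0) (true ∷ w) + ∂ (flagHRec (suc d) 0) (true ∷ w) ∎
    where
    k  = + jump 0 d
    H₀ = flagHRec d 0
    H₁ = flagHRec d 1
    Y₀ = flagHRec (suc d) 0 w
    Y₁ = flagHRec (suc d) 1 w
    ∂H₀ : ∂ H₀ w ≡ Y₀ - (a· H₀ w + b· H₀ w)
    ∂H₀ = x≡y+z⇒z≡x-y (trans (flagHRec-∂ d w) (cong (_+ ∂ H₀ w) (c·-split H₀ w)))
    combine : ∀ k a₀ b₀ a₁ b₁ g₁ Y₀ Y₁ g₀ →
              Y₀ ≡ a₁ + (k * b₀ - b₁) → g₀ ≡ Y₀ - (a₀ + b₀) → Y₁ ≡ Y₀ + b₁ + g₁ →
              (+ 1 + k) * Y₀ - Y₁ ≡ Y₀ + ((k * a₀ - a₁) + (k * g₀ - g₁))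
    combine k a₀ b₀ a₁ b₁ g₁ _ _ _ refl refl refl = solve (k List.∷ a₀ List.∷ b₀ List.∷ a₁ List.∷ b₁ List.∷ g₁ List.∷ List.[])

  flagHRec-gap : ∀ d g w → flagHRec (suc d) (suc g) w
               ≡ flagHRec (suc d) g w + b· (flagHRec d (suc g)) w + ∂ (flagHRec d (suc g)) w
  flagHRec-gap zero    g (false ∷ []) = refl
  flagHRec-gap zero    g (true  ∷ []) = begin
    + jump (suc g) 0 * + 1 - + 1        ≡⟨ cong (λ n → + n * + 1 - + 1) (jump-pascal-top g) ⟩
    + (jump g 0 ℕ.+ 1) * + 1 - + 1      ≡⟨ cong (λ z → z * + 1 - + 1) (ℤᵖ.pos-+ (jump g 0) 1) ⟩
    (+ jump g 0 + + 1) * + 1 - + 1      ≡⟨ regroup (+ jump g 0) ⟩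
    + jump g 0 * + 1 - + 1 + + 1 + + 0  ∎
    where regroup : ∀ j → (j + + 1) * + 1 - + 1 ≡ j * + 1 - + 1 + + 1 + + 0
          regroup = solve-∀
  flagHRec-gap (suc d) g (false ∷ w)  = trans (flagHRec-gap d (suc g) w) (regroup (flagHRec (suc d) (suc g) w) _ _)
    where regroup : ∀ x y z → x + y + z ≡ x + + 0 + (y + z)
          regroup = solve-∀
  flagHRec-gap (suc d) g (true  ∷ w)  = begin
    + jump (suc g) (suc d) * Y₀ - Y₂
      ≡⟨ cong (λ n → + n * Y₀ - Y₂) (jump-pascal g d) ⟩
    + (jump g (suc d) ℕ.+ jump (suc g) d) * Y₀ - Y₂
      ≡⟨ cong (λ z → z * Y₀ - Y₂) (ℤᵖ.pos-+ (jump g (suc d)) (jump (suc g) d)) ⟩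
    (k′ + k) * Y₀ - Y₂
      ≡⟨ combine k k′ (a· H₀ w) (b· H₀ w) (a· H₂ w) (b· H₂ w) Y₀ Y₂ Y₁ (∂ H₀ w) (∂ H₂ w)
                 (flagHRec-split d (suc g) w) ∂H₀ (x≡y+z⇒z≡x-y (flagHRec-gap d (suc g) w)) ⟩
    (k′ * Y₀ - Y₁) + Y₁ + ((k * a· H₀ w - a· H₂ w) + (k * ∂ H₀ w - ∂ H₂ w))
      ≡⟨ sym (cong (_+_ (k′ * Y₀ - Y₁ + Y₁)) (cong₂ _+_ (φ-*- (a·-isLinear w) k H₀ H₂) (φ-*- (∂-isLinear w) k H₀ H₂))) ⟩
    flagHRec (suc (suc d)) g (true ∷ w) + b· (flagHRec (suc d) (suc g)) (true ∷ w)
      + ∂ (flagHRec (suc d) (suc g)) (true ∷ w) ∎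
    where
    k  = + jump (suc g) d
    k′ = + jump g (suc d)
    H₀ = flagHRec d 0
    H₂ = flagHRec d (suc (suc g))
    Y₀ = flagHRec (suc d) 0 w
    Y₁ = flagHRec (suc d) (suc g) w
    Y₂ = flagHRec (suc d) (suc (suc g)) w
    ∂H₀ : ∂ H₀ w ≡ Y₀ - (a· H₀ w + b· H₀ w)
    ∂H₀ = x≡y+z⇒z≡x-y (trans (flagHRec-∂ d w) (cong (_+ ∂ H₀ w) (c·-split H₀ w)))
    combine : ∀ k k′ a₀ b₀ a₂ b₂ Y₀ Y₂ Y₁ g₀ g₂ →
              Y₁ ≡ a₂ + (k * b₀ - b₂) → g₀ ≡ Y₀ - (a₀ + b₀) → g₂ ≡ Y₂ - (Y₁ + b₂) →
              (k′ + k) * Y₀ - Y₂ ≡ (k′ * Y₀ - Y₁) + Y₁ + ((k * a₀ - a₂) + (k * g₀ - g₂))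
    combine k k′ a₀ b₀ a₂ b₂ Y₀ Y₂ _ _ _ refl refl refl = solve (k List.∷ k′ List.∷ a₀ List.∷ b₀ List.∷ a₂ List.∷ b₂ List.∷ Y₀ List.∷ Y₂ List.∷ List.[])

cdIndex : (d : ℕ) → CDPoly d
cdIndex zero    ε = + 1
cdIndex (suc d) v = c·ᶜᵈ (cdIndex d) v + ∂ᶜᵈ (cdIndex d) v

expand-cdIndex : ∀ d w → expand (cdIndex d) w ≡ flagHRec d 0 w
expand-cdIndex zero    []    = refl
expand-cdIndex (suc d) w     = begin
  expand (λ v → c·ᶜᵈ Ψ v + ∂ᶜᵈ Ψ v) w
    ≡⟨ φ-+ (expand-isLinear w) (c·ᶜᵈ Ψ) (∂ᶜᵈ Ψ) ⟩
  expand (c·ᶜᵈ Ψ) w + expand (∂ᶜᵈ Ψ) w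
    ≡⟨ cong₂ _+_ (expand-c·ᶜᵈ Ψ w) (expand-∂ Ψ w) ⟩
  c· (expand Ψ) w + ∂ (expand Ψ) w
    ≡⟨ cong₂ _+_ (φ-cong (c·-isLinear w) (expand-cdIndex d)) (φ-cong (∂-isLinear w) (expand-cdIndex d)) ⟩
  c· (flagHRec d 0) w + ∂ (flagHRec d 0) w
    ≡⟨ sym (flagHRec-∂ d w) ⟩
  flagHRec (suc d) 0 w ∎
  where Ψ = cdIndex d

sumℕ-cong : ∀ {A : Set} {f g : A → ℕ} (L : List A) → (∀ x → f x ≡ g x) → sumℕ (map f L) ≡ sumℕ (map g L)
sumℕ-cong []      e = refl
sumℕ-cong (x ∷ L) e = cong₂ ℕ._+_ (e x) (sumℕ-cong L e)

sumℕ-+ : ∀ {A : Set} (f g : A → ℕ) (L : List A) →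
         sumℕ (map (λ x → f x ℕ.+ g x) L) ≡ sumℕ (map f L) ℕ.+ sumℕ (map g L)
sumℕ-+ f g []      = refl
sumℕ-+ f g (x ∷ L) = trans (cong (f x ℕ.+ g x ℕ.+_) (sumℕ-+ f g L)) (interchange (f x) (g x) _ _)
  where interchange : ∀ a b c d → a ℕ.+ b ℕ.+ (c ℕ.+ d) ≡ a ℕ.+ c ℕ.+ (b ℕ.+ d)
        interchange = ℕ-Solver.solve-∀

sumℕ-zero : ∀ {A : Set} (L : List A) → sumℕ (map (λ _ → 0) L) ≡ 0
sumℕ-zero []      = refl
sumℕ-zero (x ∷ L) = sumℕ-zero L

sumℕ-indicator : ∀ {A : Set} (p : A → Bool) (n : ℕ) (L : List A) →
                 sumℕ (map (λ x → if p x then n else 0) L) ≡ sumℕ (map (λ x → if p x then 1 else 0) L) ℕ.* n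
sumℕ-indicator p n []      = refl
sumℕ-indicator p n (x ∷ L) with p x
... | true  = cong (n ℕ.+_) (sumℕ-indicator p n L)
... | false = sumℕ-indicator p n L

sumℕ-allVecs : ∀ {n} (f : Vec Bool (suc n) → ℕ) →
               sumℕ (map f (allVecs (suc n))) ≡ sumℕ (map (λ v → f (false ∷ v) ℕ.+ f (true ∷ v)) (allVecs n))
sumℕ-allVecs {n} f = pairs (allVecs n)
  where pairs : ∀ L → sumℕ (map f (concatMap (λ v → (false ∷ v) ∷ (true ∷ v) ∷ []) L))
                    ≡ sumℕ (map (λ v → f (false ∷ v) ℕ.+ f (true ∷ v)) L)
        pairs []      = refl
        pairs (v ∷ L) = trans (cong (λ s → f (false ∷ v) ℕ.+ (f (true ∷ v) ℕ.+ s)) (pairs L))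
                              (sym (ℕᵖ.+-assoc (f (false ∷ v)) _ _))

sumℤ-allVecs : ∀ {n} (f : Vec Bool (suc n) → ℤ) →
               sumℤ (map f (allVecs (suc n))) ≡ sumℤ (map (λ v → f (false ∷ v) + f (true ∷ v)) (allVecs n))
sumℤ-allVecs {n} f = pairs (allVecs n)
  where pairs : ∀ L → sumℤ (map f (concatMap (λ v → (false ∷ v) ∷ (true ∷ v) ∷ []) L))
                    ≡ sumℤ (map (λ v → f (false ∷ v) + f (true ∷ v)) L)
        pairs []      = refl
        pairs (v ∷ L) = trans (cong (λ s → f (false ∷ v) + (f (true ∷ v) + s)) (pairs L))
                              (sym (ℤᵖ.+-assoc (f (false ∷ v)) _ _))

cocard : ∀ {m} → Vec Bool m → ℕ
cocard []          = 0
cocard (false ∷ x) = suc (cocard x)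
cocard (true  ∷ x) = cocard x

cocard≡∸card : ∀ {m} (x : Vec Bool m) → m ℕ.∸ card x ≡ cocard x
cocard≡∸card []                = refl
cocard≡∸card {suc m} (false ∷ x) = trans (ℕᵖ.+-∸-assoc 1 (card≤ x)) (cong suc (cocard≡∸card x))
  where card≤ : ∀ {m} (x : Vec Bool m) → card x ≤ m
        card≤ []          = z≤n
        card≤ (false ∷ x) = ℕᵖ.m≤n⇒m≤1+n (card≤ x)
        card≤ (true  ∷ x) = s≤s (card≤ x)
cocard≡∸card (true  ∷ x) = cocard≡∸card x

-- supersets f c k counts the k-element sets containing a fixed c-element set
-- inside a (c + f)-element set.
supersets : ℕ → ℕ → ℕ → ℕ
supersets f zero    k       = f C k
supersets f (suc c) zero    = 0
supersets f (suc c) (suc k) = supersets f c k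

supersets-suc-zero : ∀ f c → supersets (suc f) c 0 ≡ supersets f c 0
supersets-suc-zero f zero    = refl
supersets-suc-zero f (suc c) = refl

supersets-suc : ∀ f c k → supersets (suc f) c (suc k) ≡ supersets f c (suc k) ℕ.+ supersets f c k
supersets-suc f zero    k       = trans (sym (nCk+nC[k+1]≡[n+1]C[k+1] f k)) (ℕᵖ.+-comm (f C k) _)
supersets-suc f (suc c) zero    = trans (supersets-suc-zero f c) (sym (ℕᵖ.+-identityʳ _))
supersets-suc f (suc c) (suc k) = supersets-suc f c k

supersets-shift : ∀ f c e → supersets f c (c ℕ.+ e) ≡ f C e
supersets-shift f zero    e = refl
supersets-shift f (suc c) e = supersets-shift f c e

aboveOfRank : ∀ {m} → Vec Bool m → ℕ → Vec Bool m → ℕ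
aboveOfRank x k y = if incl x y ∧ (card y ≡ᵇ k) then 1 else 0

countAbove : ∀ {m} → Vec Bool m → ℕ → ℕ
countAbove {m} x k = sumℕ (map (aboveOfRank x k) (allVecs m))

countAbove-split : ∀ {m} (x : Vec Bool m) k → countAbove (false ∷ x) k ≡ countAbove x k ℕ.+ countAbove (true ∷ x) k
countAbove-split {m} x k = begin
  countAbove (false ∷ x) k
    ≡⟨ sumℕ-allVecs (aboveOfRank (false ∷ x) k) ⟩
  sumℕ (map (λ v → aboveOfRank x k v ℕ.+ aboveOfRank (true ∷ x) k (true ∷ v)) (allVecs m))
    ≡⟨ sumℕ-+ (aboveOfRank x k) (λ v → aboveOfRank (true ∷ x) k (true ∷ v)) (allVecs m) ⟩
  countAbove x k ℕ.+ sumℕ (map (λ v → aboveOfRank (true ∷ x) k (true ∷ v)) (allVecs m))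
    ≡⟨ cong (countAbove x k ℕ.+_) (sym (sumℕ-allVecs (aboveOfRank (true ∷ x) k))) ⟩
  countAbove x k ℕ.+ countAbove (true ∷ x) k ∎

countAbove-true-suc : ∀ {m} (x : Vec Bool m) k → countAbove (true ∷ x) (suc k) ≡ countAbove x k
countAbove-true-suc x k = sumℕ-allVecs (aboveOfRank (true ∷ x) (suc k))

countAbove-true-zero : ∀ {m} (x : Vec Bool m) → countAbove (true ∷ x) 0 ≡ 0
countAbove-true-zero {m} x = begin
  countAbove (true ∷ x) 0
    ≡⟨ sumℕ-allVecs (aboveOfRank (true ∷ x) 0) ⟩
  sumℕ (map (λ v → if incl x v ∧ false then 1 else 0) (allVecs m))
    ≡⟨ sumℕ-cong (allVecs m) (λ v → cong (λ b → if b then 1 else 0) (∧-zeroʳ (incl x v))) ⟩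
  sumℕ (map (λ _ → 0) (allVecs m))
    ≡⟨ sumℕ-zero (allVecs m) ⟩
  0 ∎

countAbove-supersets : ∀ {m} (x : Vec Bool m) k → countAbove x k ≡ supersets (cocard x) (card x) k
countAbove-supersets []          zero    = refl
countAbove-supersets []          (suc k) = refl
countAbove-supersets (false ∷ x) zero    = begin
  countAbove (false ∷ x) 0                   ≡⟨ countAbove-split x 0 ⟩
  countAbove x 0 ℕ.+ countAbove (true ∷ x) 0 ≡⟨ cong₂ ℕ._+_ (countAbove-supersets x 0) (countAbove-true-zero x) ⟩
  supersets (cocard x) (card x) 0 ℕ.+ 0 ≡⟨ ℕᵖ.+-identityʳ _ ⟩
  supersets (cocard x) (card x) 0       ≡⟨ sym (supersets-suc-zero (cocard x) (card x)) ⟩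
  supersets (suc (cocard x)) (card x) 0 ∎
countAbove-supersets (false ∷ x) (suc k) = begin
  countAbove (false ∷ x) (suc k)               ≡⟨ countAbove-split x (suc k) ⟩
  countAbove x (suc k) ℕ.+ countAbove (true ∷ x) (suc k)
    ≡⟨ cong₂ ℕ._+_ (countAbove-supersets x (suc k)) (trans (countAbove-true-suc x k) (countAbove-supersets x k)) ⟩
  supersets (cocard x) (card x) (suc k) ℕ.+ supersets (cocard x) (card x) k
                                               ≡⟨ sym (supersets-suc (cocard x) (card x) k) ⟩
  supersets (suc (cocard x)) (card x) (suc k)  ∎
countAbove-supersets (true  ∷ x) zero    = countAbove-true-zero x
countAbove-supersets (true  ∷ x) (suc k) = trans (countAbove-true-suc x k) (countAbove-supersets x k)

chainCount : ℕ → ℕ → List ℕ → ℕ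
chainCount m c []       = 1
chainCount m c (k ∷ ks) = supersets (m ℕ.∸ c) c k ℕ.* chainCount m k ks

chainsFrom-chainCount : ∀ m ks (x : Vec Bool m) → chainsFrom m x ks ≡ chainCount m (card x) ks
chainsFrom-chainCount m []       x = refl
chainsFrom-chainCount m (k ∷ ks) x = begin
  sumℕ (map (λ y → if incl x y ∧ (card y ≡ᵇ k) then chainsFrom m y ks else 0) (allVecs m))
    ≡⟨ sumℕ-cong (allVecs m) (λ y → if-∧-cong (incl x y) (card y ≡ᵇ k) (λ eq →
         trans (chainsFrom-chainCount m ks y) (cong (λ c → chainCount m c ks) (ℕᵖ.≡ᵇ⇒≡ (card y) k eq)))) ⟩
  sumℕ (map (λ y → if incl x y ∧ (card y ≡ᵇ k) then chainCount m k ks else 0) (allVecs m))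
    ≡⟨ sumℕ-indicator (λ y → incl x y ∧ (card y ≡ᵇ k)) (chainCount m k ks) (allVecs m) ⟩
  countAbove x k ℕ.* chainCount m k ks
    ≡⟨ cong (ℕ._* chainCount m k ks) (countAbove-supersets x k) ⟩
  supersets (cocard x) (card x) k ℕ.* chainCount m k ks
    ≡⟨ cong (λ f → supersets f (card x) k ℕ.* chainCount m k ks) (sym (cocard≡∸card x)) ⟩
  supersets (m ℕ.∸ card x) (card x) k ℕ.* chainCount m k ks ∎
  where if-∧-cong : ∀ p q {u v : ℕ} → (T q → u ≡ v) → (if p ∧ q then u else 0) ≡ (if p ∧ q then v else 0)
        if-∧-cong true  true  eq = eq _
        if-∧-cong true  false eq = refl
        if-∧-cong false q     eq = refl

-- flagFRec d g T counts the chains above an element x of a Boolean lattice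
-- with ranks rank(x) + g + i for i ∈ T, when the lattice has rank rank(x) + g + d + 1.
flagFRec : (d g : ℕ) → Vec Bool d → ℕ
flagFRec zero    g []          = 1
flagFRec (suc d) g (false ∷ T) = flagFRec d (suc g) T
flagFRec (suc d) g (true  ∷ T) = jump g d ℕ.* flagFRec d 0 T

chainCount-flagFRec : ∀ d (T : Vec Bool d) j g {m r} → m ≡ suc (r ℕ.+ d) → r ≡ j ℕ.+ g →
                      chainCount m j (ranksFrom r T) ≡ flagFRec d g T
chainCount-flagFRec zero    []          j g eₘ eᵣ = refl
chainCount-flagFRec (suc d) (false ∷ T) j g eₘ eᵣ =
  chainCount-flagFRec d T j (suc g) (trans eₘ (cong suc (ℕᵖ.+-suc _ d))) (trans (cong suc eᵣ) (sym (ℕᵖ.+-suc j g)))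
chainCount-flagFRec (suc d) (true  ∷ T) j g {m} {r} eₘ eᵣ =
  cong₂ ℕ._*_ first-step (chainCount-flagFRec d T (suc r) 0 (trans eₘ (cong suc (ℕᵖ.+-suc r d))) (sym (ℕᵖ.+-identityʳ (suc r))))
  where
  m≡ : m ≡ j ℕ.+ suc (suc (g ℕ.+ d))
  m≡ = trans eₘ (trans (cong (λ r → suc (r ℕ.+ suc d)) eᵣ) (shift j g d))
    where shift : ∀ j g d → suc (j ℕ.+ g ℕ.+ suc d) ≡ j ℕ.+ suc (suc (g ℕ.+ d))
          shift = ℕ-Solver.solve-∀
  first-step : supersets (m ℕ.∸ j) j (suc r) ≡ jump g d
  first-step = begin
    supersets (m ℕ.∸ j) j (suc r)
      ≡⟨ cong (supersets (m ℕ.∸ j) j) (trans (cong suc eᵣ) (sym (ℕᵖ.+-suc j g))) ⟩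
    supersets (m ℕ.∸ j) j (j ℕ.+ suc g)
      ≡⟨ supersets-shift (m ℕ.∸ j) j (suc g) ⟩
    (m ℕ.∸ j) C suc g
      ≡⟨ cong (λ n → (n ℕ.∸ j) C suc g) m≡ ⟩
    (j ℕ.+ suc (suc (g ℕ.+ d)) ℕ.∸ j) C suc g
      ≡⟨ cong (_C suc g) (ℕᵖ.m+n∸m≡n j _) ⟩
    jump g d ∎

fB-flagFRec : ∀ r T → fB r T ≡ flagFRec r 0 T
fB-flagFRec r T = begin
  chainsFrom (suc r) (bottom (suc r)) (ranks T)
    ≡⟨ chainsFrom-chainCount (suc r) (ranks T) (bottom (suc r)) ⟩
  chainCount (suc r) (card (bottom (suc r))) (ranks T)
    ≡⟨ cong (λ c → chainCount (suc r) c (ranks T)) (card-bottom (suc r)) ⟩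
  chainCount (suc r) 0 (ranks T)
    ≡⟨ chainCount-flagFRec r T 0 0 refl refl ⟩
  flagFRec r 0 T ∎
  where card-bottom : ∀ m → card (bottom m) ≡ 0
        card-bottom zero    = refl
        card-bottom (suc m) = card-bottom m

flagWeight : ∀ {n} → Vec Bool n → Vec Bool n → ℤ
flagWeight T S = if incl T S then sign (card S ℕ.∸ card T) else + 0

flagH : ∀ {n} → ABPoly n → ABPoly n
flagH {n} F S = sumℤ (map (λ T → F T * flagWeight T S) (allVecs n))

flagH-isLinear : ∀ {n} (S : Vec Bool n) → IsLinear (λ (F : ABPoly n) → flagH F S)
flagH-isLinear {n} S = weighted-isLinear (λ T → flagWeight T S) (sumℤ-isLinear (allVecs n))

hB-flagH : ∀ r S → hB r S ≡ flagH (λ T → + fB r T) S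
hB-flagH r S = Sumℤ.φ-cong (allVecs r) (λ T → swap (incl T S) (sign (card S ℕ.∸ card T)) (+ fB r T))
  where swap : ∀ b s x → (if b then s * x else + 0) ≡ x * (if b then s else + 0)
        swap true  s x = ℤᵖ.*-comm s x
        swap false s x = sym (ℤᵖ.*-zeroʳ x)

flagWeight-false-true : ∀ {n} (T S : Vec Bool n) → flagWeight (false ∷ T) (true ∷ S) ≡ - flagWeight T S
flagWeight-false-true T S with incl T S in eq
... | true  = trans (cong sign (ℕᵖ.+-∸-assoc 1 (incl⇒card≤ T S eq))) (sign-suc (card S ℕ.∸ card T))
  where
  incl⇒card≤ : ∀ {n} (T S : Vec Bool n) → incl T S ≡ true → card T ≤ card S
  incl⇒card≤ []          []          eq = z≤n
  incl⇒card≤ (false ∷ T) (false ∷ S) eq = incl⇒card≤ T S eq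
  incl⇒card≤ (false ∷ T) (true  ∷ S) eq = ℕᵖ.m≤n⇒m≤1+n (incl⇒card≤ T S eq)
  incl⇒card≤ (true  ∷ T) (true  ∷ S) eq = s≤s (incl⇒card≤ T S eq)
  sign-suc : ∀ k → sign (suc k) ≡ - sign k
  sign-suc zero          = refl
  sign-suc (suc zero)    = refl
  sign-suc (suc (suc k)) = sign-suc k
... | false = refl

flagH-[] : (F : ABPoly 0) → flagH F [] ≡ F []
flagH-[] F = trans (ℤᵖ.+-identityʳ _) (ℤᵖ.*-identityʳ (F []))

flagH-false : ∀ {n} (F : ABPoly (suc n)) S → flagH F (false ∷ S) ≡ flagH (λ T → F (false ∷ T)) S
flagH-false {n} F S = trans (sumℤ-allVecs (λ T → F T * flagWeight T (false ∷ S))) (Sumℤ.φ-cong (allVecs n) drop-true)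
  where drop-true : ∀ T → F (false ∷ T) * flagWeight T S + F (true ∷ T) * + 0 ≡ F (false ∷ T) * flagWeight T S
        drop-true T = trans (cong (_+_ (F (false ∷ T) * flagWeight T S)) (ℤᵖ.*-zeroʳ (F (true ∷ T)))) (ℤᵖ.+-identityʳ _)

flagH-true : ∀ {n} (F : ABPoly (suc n)) S →
             flagH F (true ∷ S) ≡ flagH (λ T → F (true ∷ T)) S - flagH (λ T → F (false ∷ T)) S
flagH-true {n} F S = begin
  flagH F (true ∷ S)
    ≡⟨ sumℤ-allVecs (λ T → F T * flagWeight T (true ∷ S)) ⟩
  sumℤ (map (λ T → F (false ∷ T) * flagWeight (false ∷ T) (true ∷ S) + F (true ∷ T) * flagWeight T S) (allVecs n))
    ≡⟨ Sumℤ.φ-cong (allVecs n) (λ T → trans (cong (λ w → F (false ∷ T) * w + F (true ∷ T) * flagWeight T S) (flagWeight-false-true T S))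
                                           (rearrange (F (false ∷ T)) (F (true ∷ T)) (flagWeight T S))) ⟩
  sumℤ (map (λ T → F (true ∷ T) * flagWeight T S - F (false ∷ T) * flagWeight T S) (allVecs n))
    ≡⟨ Sumℤ.φ-− (allVecs n) (λ T → F (true ∷ T) * flagWeight T S) (λ T → F (false ∷ T) * flagWeight T S) ⟩
  flagH (λ T → F (true ∷ T)) S - flagH (λ T → F (false ∷ T)) S ∎
  where rearrange : ∀ x y w → x * - w + y * w ≡ y * w - x * w
        rearrange = solve-∀

flagH-flagFRec : ∀ d g S → flagH (λ T → + flagFRec d g T) S ≡ flagHRec d g S
flagH-flagFRec zero    g []          = flagH-[] (λ T → + flagFRec 0 g T)
flagH-flagFRec (suc d) g (false ∷ S) = trans (flagH-false (λ T → + flagFRec (suc d) g T) S) (flagH-flagFRec d (suc g) S)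
flagH-flagFRec (suc d) g (true  ∷ S) = begin
  flagH (λ T → + flagFRec (suc d) g T) (true ∷ S)
    ≡⟨ flagH-true (λ T → + flagFRec (suc d) g T) S ⟩
  flagH (λ T → + (jump g d ℕ.* flagFRec d 0 T)) S - flagH (λ T → + flagFRec d (suc g) T) S
    ≡⟨ cong₂ _-_ (trans (φ-cong (flagH-isLinear S) (λ T → ℤᵖ.pos-* (jump g d) (flagFRec d 0 T)))
                        (φ-* (flagH-isLinear S) (+ jump g d) (λ T → + flagFRec d 0 T)))
                 (flagH-flagFRec d (suc g) S) ⟩
  + jump g d * flagH (λ T → + flagFRec d 0 T) S - flagHRec d (suc g) S
    ≡⟨ cong (λ h → + jump g d * h - flagHRec d (suc g) S) (flagH-flagFRec d 0 S) ⟩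
  flagHRec (suc d) g (true ∷ S) ∎

hB-flagHRec : ∀ r S → hB r S ≡ flagHRec r 0 S
hB-flagHRec r S = begin
  hB r S                           ≡⟨ hB-flagH r S ⟩
  flagH (λ T → + fB r T) S         ≡⟨ φ-cong (flagH-isLinear S) (λ T → cong +_ (fB-flagFRec r T)) ⟩
  flagH (λ T → + flagFRec r 0 T) S ≡⟨ flagH-flagFRec r 0 S ⟩
  flagHRec r 0 S                   ∎

cdIndex-isCDIndexB : ∀ r → IsCDIndexB r (cdIndex r)
cdIndex-isCDIndexB r w = trans (expand-cdIndex r w) (sym (hB-flagHRec r w))

-- Specialising the variables to a = 1 and b = -1

alternatingSum : ∀ {n} → ABPoly n → ℤ
alternatingSum {zero}  F = F []
alternatingSum {suc n} F = alternatingSum (λ v → F (false ∷ v)) - alternatingSum (λ v → F (true ∷ v))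

alternatingSum-isLinear : ∀ {n} → IsLinear (alternatingSum {n})
alternatingSum-isLinear {zero}  = eval-isLinear []
alternatingSum-isLinear {suc n} = −-isLinear (precomp-isLinear (false ∷_) alternatingSum-isLinear)
                                             (precomp-isLinear (true ∷_) alternatingSum-isLinear)

cdWeight : ∀ {n} → CDWord n → ℤ
cdWeight ε      = + 1
cdWeight (c∷ v) = + 0
cdWeight (d∷ v) = - + 2 * cdWeight v

alternatingSum-expandWord : ∀ {n} (v : CDWord n) → alternatingSum (expandWord v) ≡ cdWeight v
alternatingSum-expandWord ε               = refl
alternatingSum-expandWord (c∷ v)          = ℤᵖ.+-inverseʳ (alternatingSum (expandWord v))
alternatingSum-expandWord {suc (suc n)} (d∷ v) = begin
  (alternatingSum {n} (λ _ → + 0) - e) - (e - alternatingSum {n} (λ _ → + 0))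
    ≡⟨ cong₂ (λ z z′ → (z - e) - (e - z′)) (φ-0 (alternatingSum-isLinear {n})) (φ-0 (alternatingSum-isLinear {n})) ⟩
  (+ 0 - e) - (e - + 0)
    ≡⟨ twice e ⟩
  - + 2 * e
    ≡⟨ cong (- + 2 *_) (alternatingSum-expandWord v) ⟩
  - + 2 * cdWeight v ∎
  where e = alternatingSum (expandWord v)
        twice : ∀ e → (+ 0 - e) - (e - + 0) ≡ - + 2 * e
        twice = solve-∀

alternatingSum-expand : ∀ {n} (ψ : CDPoly n) → alternatingSum (expand ψ) ≡ sumℤ (map (λ v → ψ v * cdWeight v) (allCD n))
alternatingSum-expand {n} ψ = begin
  alternatingSum (expand ψ)
    ≡⟨ φ-sumℤ alternatingSum-isLinear (allCD n) (λ v w → ψ v * expandWord v w) ⟩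
  sumℤ (map (λ v → alternatingSum (λ w → ψ v * expandWord v w)) (allCD n))
    ≡⟨ Sumℤ.φ-cong (allCD n) (λ v → trans (φ-* alternatingSum-isLinear (ψ v) (expandWord v))
                                          (cong (ψ v *_) (alternatingSum-expandWord v))) ⟩
  sumℤ (map (λ v → ψ v * cdWeight v) (allCD n)) ∎

weightedSum-dPow : ∀ n (ψ : CDPoly (double n)) →
                   sumℤ (map (λ v → ψ v * cdWeight v) (allCD (double n))) ≡ (- + 2) ℤ.^ n * ψ (dPow n)
weightedSum-dPow zero    ψ = trans (ℤᵖ.+-identityʳ _) (trans (ℤᵖ.*-identityʳ (ψ ε)) (sym (ℤᵖ.*-identityˡ (ψ ε))))
weightedSum-dPow (suc n) ψ = begin
  sumℤ (map term (map c∷_ (allCD (suc (double n))) ++ map d∷_ (allCD (double n))))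
    ≡⟨ cong sumℤ (map-++ term (map c∷_ (allCD (suc (double n)))) (map d∷_ (allCD (double n)))) ⟩
  sumℤ (map term (map c∷_ (allCD (suc (double n)))) ++ map term (map d∷_ (allCD (double n))))
    ≡⟨ sumℤ-++ (map term (map c∷_ (allCD (suc (double n))))) (map term (map d∷_ (allCD (double n)))) ⟩
  sumℤ (map term (map c∷_ (allCD (suc (double n))))) + sumℤ (map term (map d∷_ (allCD (double n))))
    ≡⟨ cong₂ _+_ c-words d-words ⟩
  + 0 + - + 2 * ((- + 2) ℤ.^ n * ψ (dPow (suc n)))
    ≡⟨ regroup ((- + 2) ℤ.^ n) (ψ (dPow (suc n))) ⟩
  (- + 2) ℤ.^ suc n * ψ (dPow (suc n)) ∎
  where
  term : CDWord (double (suc n)) → ℤ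
  term v = ψ v * cdWeight v
  c-words : sumℤ (map term (map c∷_ (allCD (suc (double n))))) ≡ + 0
  c-words = trans (cong sumℤ (sym (map-∘ (allCD (suc (double n))))))
                  (trans (Sumℤ.φ-cong (allCD (suc (double n))) (λ v → ℤᵖ.*-zeroʳ (ψ (c∷ v)))) (Sumℤ.φ-0 (allCD (suc (double n)))))
  d-words : sumℤ (map term (map d∷_ (allCD (double n)))) ≡ - + 2 * ((- + 2) ℤ.^ n * ψ (dPow (suc n)))
  d-words = begin
    sumℤ (map term (map d∷_ (allCD (double n))))
      ≡⟨ cong sumℤ (sym (map-∘ (allCD (double n)))) ⟩
    sumℤ (map (λ v → ψ (d∷ v) * (- + 2 * cdWeight v)) (allCD (double n)))
      ≡⟨ Sumℤ.φ-cong (allCD (double n)) (λ v → pull (ψ (d∷ v)) (cdWeight v)) ⟩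
    sumℤ (map (λ v → - + 2 * (ψ (d∷ v) * cdWeight v)) (allCD (double n)))
      ≡⟨ Sumℤ.φ-* (allCD (double n)) (- + 2) (λ v → ψ (d∷ v) * cdWeight v) ⟩
    - + 2 * sumℤ (map (λ v → ψ (d∷ v) * cdWeight v) (allCD (double n)))
      ≡⟨ cong (- + 2 *_) (weightedSum-dPow n (λ v → ψ (d∷ v))) ⟩
    - + 2 * ((- + 2) ℤ.^ n * ψ (dPow (suc n))) ∎
    where pull : ∀ p e → p * (- + 2 * e) ≡ - + 2 * (p * e)
          pull = solve-∀
  regroup : ∀ p q → + 0 + - + 2 * (p * q) ≡ - + 2 * p * q
  regroup = solve-∀

altFlagH : ℕ → ℕ → ℤ
altFlagH zero    g = + 1
altFlagH (suc d) g = + 2 * altFlagH d (suc g) - + jump g d * altFlagH d 0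

alternatingSum-flagHRec : ∀ d g → alternatingSum (flagHRec d g) ≡ altFlagH d g
alternatingSum-flagHRec zero    g = refl
alternatingSum-flagHRec (suc d) g = begin
  alternatingSum (flagHRec d (suc g)) - alternatingSum (λ v → + jump g d * flagHRec d 0 v - flagHRec d (suc g) v)
    ≡⟨ cong (_-_ (alternatingSum (flagHRec d (suc g)))) (φ-*- alternatingSum-isLinear (+ jump g d) (flagHRec d 0) (flagHRec d (suc g))) ⟩
  h₁ - (+ jump g d * alternatingSum (flagHRec d 0) - h₁)
    ≡⟨ cong₂ (λ z z′ → z - (+ jump g d * z′ - z)) (alternatingSum-flagHRec d (suc g)) (alternatingSum-flagHRec d 0) ⟩
  altFlagH d (suc g) - (+ jump g d * altFlagH d 0 - altFlagH d (suc g))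
    ≡⟨ regroup (altFlagH d (suc g)) (+ jump g d) (altFlagH d 0) ⟩
  + 2 * altFlagH d (suc g) - + jump g d * altFlagH d 0 ∎
  where h₁ = alternatingSum (flagHRec d (suc g))
        regroup : ∀ z j z₀ → z - (j * z₀ - z) ≡ + 2 * z - j * z₀
        regroup = solve-∀

cdIndex-dPow : ∀ n (ψ : CDPoly (double n)) → IsCDIndexB (double n) ψ →
               (- + 2) ℤ.^ n * ψ (dPow n) ≡ altFlagH (double n) 0
cdIndex-dPow n ψ isΨ = begin
  (- + 2) ℤ.^ n * ψ (dPow n)                                  ≡⟨ sym (weightedSum-dPow n ψ) ⟩
  sumℤ (map (λ v → ψ v * cdWeight v) (allCD (double n)))     ≡⟨ sym (alternatingSum-expand ψ) ⟩
  alternatingSum (expand ψ)                                   ≡⟨ φ-cong alternatingSum-isLinear (λ w → trans (isΨ w) (hB-flagHRec (double n) w)) ⟩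
  alternatingSum (flagHRec (double n) 0)                      ≡⟨ alternatingSum-flagHRec (double n) 0 ⟩
  altFlagH (double n) 0                                       ∎

Seq : Set
Seq = ℕ → ℤ

-- The product of exponential generating functions, in the Leibniz form
-- (f ⋆ g)′ = f′ ⋆ g + f ⋆ g′.
infixl 7 _⋆_
_⋆_ : Seq → Seq → Seq
(f ⋆ g) zero    = f 0 * g 0
(f ⋆ g) (suc m) = ((λ k → f (suc k)) ⋆ g) m + (f ⋆ (λ k → g (suc k))) m

⋆-isLinearˡ : ∀ (g : Seq) m → IsLinear (λ f → (f ⋆ g) m)
⋆-isLinearˡ g zero    = weighted-isLinear g (eval-isLinear 0)
⋆-isLinearˡ g (suc m) = +-isLinear (precomp-isLinear suc (⋆-isLinearˡ g m)) (⋆-isLinearˡ (λ k → g (suc k)) m)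

⋆-comm : ∀ (f g : Seq) m → (f ⋆ g) m ≡ (g ⋆ f) m
⋆-comm f g zero    = ℤᵖ.*-comm (f 0) (g 0)
⋆-comm f g (suc m) = trans (cong₂ _+_ (⋆-comm _ g m) (⋆-comm f _ m)) (ℤᵖ.+-comm ((g ⋆ (λ k → f (suc k))) m) _)

⋆-isLinearʳ : ∀ (f : Seq) m → IsLinear (λ g → (f ⋆ g) m)
⋆-isLinearʳ f m = isLinear-≗ (λ g → ⋆-comm g f m) (⋆-isLinearˡ f m)

⋆-assoc : ∀ (f g h : Seq) m → ((f ⋆ g) ⋆ h) m ≡ (f ⋆ (g ⋆ h)) m
⋆-assoc f g h zero    = ℤᵖ.*-assoc (f 0) (g 0) (h 0)
⋆-assoc f g h (suc m) = begin
  ((λ k → (f′ ⋆ g) k + (f ⋆ g′) k) ⋆ h) m + ((f ⋆ g) ⋆ h′) m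
    ≡⟨ cong (_+ ((f ⋆ g) ⋆ h′) m) (φ-+ (⋆-isLinearˡ h m) (f′ ⋆ g) (f ⋆ g′)) ⟩
  ((f′ ⋆ g) ⋆ h) m + ((f ⋆ g′) ⋆ h) m + ((f ⋆ g) ⋆ h′) m
    ≡⟨ cong₂ _+_ (cong₂ _+_ (⋆-assoc f′ g h m) (⋆-assoc f g′ h m)) (⋆-assoc f g h′ m) ⟩
  (f′ ⋆ (g ⋆ h)) m + (f ⋆ (g′ ⋆ h)) m + (f ⋆ (g ⋆ h′)) m
    ≡⟨ ℤᵖ.+-assoc ((f′ ⋆ (g ⋆ h)) m) _ _ ⟩
  (f′ ⋆ (g ⋆ h)) m + ((f ⋆ (g′ ⋆ h)) m + (f ⋆ (g ⋆ h′)) m)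
    ≡⟨ cong (_+_ ((f′ ⋆ (g ⋆ h)) m)) (sym (φ-+ (⋆-isLinearʳ f m) (g′ ⋆ h) (g ⋆ h′))) ⟩
  (f′ ⋆ (g ⋆ h)) m + (f ⋆ (λ k → (g′ ⋆ h) k + (g ⋆ h′) k)) m ∎
  where f′ = λ k → f (suc k)
        g′ = λ k → g (suc k)
        h′ = λ k → h (suc k)

δ : Seq
δ zero    = + 1
δ (suc k) = + 0

δ-⋆ : ∀ (g : Seq) m → (δ ⋆ g) m ≡ g m
δ-⋆ g zero    = ℤᵖ.*-identityˡ (g 0)
δ-⋆ g (suc m) = begin
  ((λ _ → + 0) ⋆ g) m + (δ ⋆ (λ k → g (suc k))) m ≡⟨ cong₂ _+_ (φ-0 (⋆-isLinearˡ g m)) (δ-⋆ (λ k → g (suc k)) m) ⟩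
  + 0 + g (suc m)                                    ≡⟨ ℤᵖ.+-identityˡ (g (suc m)) ⟩
  g (suc m)                                          ∎

Σ< : ℕ → Seq → ℤ
Σ< n f = sumℤ (applyUpTo f n)

Σ<-isLinear : ∀ n → IsLinear (Σ< n)
Σ<-isLinear n = isLinear-≗ (λ f → cong sumℤ (map-upTo f n)) (sumℤ-isLinear (upTo n))

Σ<-cong< : ∀ n {f g : Seq} → (∀ i → i < n → f i ≡ g i) → Σ< n f ≡ Σ< n g
Σ<-cong< zero    e = refl
Σ<-cong< (suc n) e = cong₂ _+_ (e 0 (s≤s z≤n)) (Σ<-cong< n (λ i i<n → e (suc i) (s≤s i<n)))

Σ<-last : ∀ n (f : Seq) → Σ< (suc n) f ≡ Σ< n f + f n
Σ<-last n f = begin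
  sumℤ (applyUpTo f (suc n))        ≡⟨ cong sumℤ (sym (applyUpTo-∷ʳ f n)) ⟩
  sumℤ (applyUpTo f n ++ f n ∷ [])  ≡⟨ sumℤ-++ (applyUpTo f n) (f n ∷ []) ⟩
  Σ< n f + (f n + + 0)              ≡⟨ cong (_+_ (Σ< n f)) (ℤᵖ.+-identityʳ (f n)) ⟩
  Σ< n f + f n                      ∎

binomialSum : ℕ → Seq → Seq → ℤ
binomialSum N f g = Σ< (suc N) (λ k → + (N C k) * f k * g (N ℕ.∸ k))

binomialSum-suc : ∀ N (f g : Seq) →
                  binomialSum (suc N) f g ≡ binomialSum N (λ k → f (suc k)) g + binomialSum N f (λ k → g (suc k))
binomialSum-suc N f g = begin
  first + Σ< (suc N) (λ i → + (suc N C suc i) * f (suc i) * g (N ℕ.∸ i))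
    ≡⟨ cong (_+_ first) (φ-cong (Σ<-isLinear (suc N)) pascal) ⟩
  first + Σ< (suc N) (λ i → left i + right i)
    ≡⟨ cong (_+_ first) (φ-+ (Σ<-isLinear (suc N)) left right) ⟩
  first + (binomialSum N (λ k → f (suc k)) g + Σ< (suc N) right)
    ≡⟨ cong (λ s → first + (binomialSum N (λ k → f (suc k)) g + s)) (trans (Σ<-last N right) right-last) ⟩
  first + (binomialSum N (λ k → f (suc k)) g + Σ< N right)
    ≡⟨ swap first (binomialSum N (λ k → f (suc k)) g) (Σ< N right) ⟩
  binomialSum N (λ k → f (suc k)) g + (first + Σ< N right)
    ≡⟨ cong (λ s → binomialSum N (λ k → f (suc k)) g + (first + s)) (Σ<-cong< N shift) ⟩
  binomialSum N (λ k → f (suc k)) g + binomialSum N f (λ k → g (suc k)) ∎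
  where
  first = + 1 * f 0 * g (suc N)
  left right : Seq
  left  i = + (N C i) * f (suc i) * g (N ℕ.∸ i)
  right i = + (N C suc i) * f (suc i) * g (N ℕ.∸ i)
  pascal : ∀ i → + (suc N C suc i) * f (suc i) * g (N ℕ.∸ i) ≡ left i + right i
  pascal i = begin
    + (suc N C suc i) * f (suc i) * g (N ℕ.∸ i)
      ≡⟨ cong (λ c → + c * f (suc i) * g (N ℕ.∸ i)) (sym (nCk+nC[k+1]≡[n+1]C[k+1] N i)) ⟩
    + (N C i ℕ.+ N C suc i) * f (suc i) * g (N ℕ.∸ i)
      ≡⟨ cong (λ c → c * f (suc i) * g (N ℕ.∸ i)) (ℤᵖ.pos-+ (N C i) (N C suc i)) ⟩
    (+ (N C i) + + (N C suc i)) * f (suc i) * g (N ℕ.∸ i)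
      ≡⟨ distrib (+ (N C i)) (+ (N C suc i)) (f (suc i)) (g (N ℕ.∸ i)) ⟩
    left i + right i ∎
    where distrib : ∀ a b x y → (a + b) * x * y ≡ a * x * y + b * x * y
          distrib = solve-∀
  right-last : Σ< N right + right N ≡ Σ< N right
  right-last = begin
    Σ< N right + + (N C suc N) * f (suc N) * g (N ℕ.∸ N)
      ≡⟨ cong (λ c → Σ< N right + + c * f (suc N) * g (N ℕ.∸ N)) (k>n⇒nCk≡0 (ℕᵖ.n<1+n N)) ⟩
    Σ< N right + + 0 * f (suc N) * g (N ℕ.∸ N)
      ≡⟨ cong (_+_ (Σ< N right)) (ℤᵖ.*-zeroˡ (g (N ℕ.∸ N))) ⟩
    Σ< N right + + 0
      ≡⟨ ℤᵖ.+-identityʳ (Σ< N right) ⟩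
    Σ< N right ∎
  shift : ∀ i → i < N → right i ≡ + (N C suc i) * f (suc i) * g (suc (N ℕ.∸ suc i))
  shift i i<N = cong (λ j → + (N C suc i) * f (suc i) * g j) (ℕᵖ.+-∸-assoc 1 i<N)
  swap : ∀ x y z → x + (y + z) ≡ y + (x + z)
  swap = solve-∀

binomialSum≡⋆ : ∀ N (f g : Seq) → binomialSum N f g ≡ (f ⋆ g) N
binomialSum≡⋆ zero    f g = trans (ℤᵖ.+-identityʳ _) (cong (_* g 0) (ℤᵖ.*-identityˡ (f 0)))
binomialSum≡⋆ (suc N) f g = trans (binomialSum-suc N f g) (cong₂ _+_ (binomialSum≡⋆ N _ g) (binomialSum≡⋆ N f _))

-- The generating function tanh x

τ : Seq
τ zero    = + 0
τ (suc d) = altFlagH d 0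

pow2 : Seq
pow2 k = + (2 ^ k)

altFlagH-closed : ∀ d g → altFlagH d g
                ≡ + (2 ^ d) - Σ< d (λ i → + (2 ^ i) * + (suc (d ℕ.+ g) C suc (g ℕ.+ i)) * τ (d ℕ.∸ i))
altFlagH-closed zero    g = refl
altFlagH-closed (suc d) g = begin
  + 2 * altFlagH d (suc g) - + jump g d * altFlagH d 0
    ≡⟨ cong₂ (λ z j → + 2 * z - + j * altFlagH d 0) (altFlagH-closed d (suc g)) jump≡ ⟩
  + 2 * (+ (2 ^ d) - S) - + B * altFlagH d 0
    ≡⟨ regroup (+ (2 ^ d)) S (+ B) (altFlagH d 0) ⟩
  + 2 * + (2 ^ d) - (+ 1 * + B * altFlagH d 0 + + 2 * S)
    ≡⟨ cong₂ _-_ (sym (ℤᵖ.pos-* 2 (2 ^ d))) (cong (_+_ (+ 1 * + B * altFlagH d 0)) (sym tail)) ⟩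
  + (2 ^ suc d) - Σ< (suc d) (λ i → + (2 ^ i) * + (suc (suc d ℕ.+ g) C suc (g ℕ.+ i)) * τ (suc d ℕ.∸ i)) ∎
  where
  B = suc (suc d ℕ.+ g) C suc (g ℕ.+ 0)
  S = Σ< d (λ i → + (2 ^ i) * + (suc (d ℕ.+ suc g) C suc (suc g ℕ.+ i)) * τ (d ℕ.∸ i))
  jump≡ : jump g d ≡ B
  jump≡ = cong₂ (λ n k → suc (suc n) C suc k) (ℕᵖ.+-comm g d) (sym (ℕᵖ.+-identityʳ g))
  tail : Σ< d (λ i → + (2 ^ suc i) * + (suc (suc d ℕ.+ g) C suc (g ℕ.+ suc i)) * τ (d ℕ.∸ i)) ≡ + 2 * S
  tail = trans (φ-cong (Σ<-isLinear d) term) (φ-* (Σ<-isLinear d) (+ 2) _)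
    where
    term : ∀ i → + (2 ^ suc i) * + (suc (suc d ℕ.+ g) C suc (g ℕ.+ suc i)) * τ (d ℕ.∸ i)
               ≡ + 2 * (+ (2 ^ i) * + (suc (d ℕ.+ suc g) C suc (suc g ℕ.+ i)) * τ (d ℕ.∸ i))
    term i = trans (cong₂ (λ p c → p * + c * τ (d ℕ.∸ i))
                          (ℤᵖ.pos-* 2 (2 ^ i))
                          (cong₂ (λ n k → suc n C suc k) (sym (ℕᵖ.+-suc d g)) (ℕᵖ.+-suc g i)))
                   (reassoc (+ 2) (+ (2 ^ i)) _ (τ (d ℕ.∸ i)))
      where reassoc : ∀ a b c x → a * b * c * x ≡ a * (b * c * x)
            reassoc = solve-∀
  regroup : ∀ p s b z → + 2 * (p - s) - b * z ≡ + 2 * p - (+ 1 * b * z + + 2 * s)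
  regroup = solve-∀

pow2-τ : ∀ N → binomialSum N pow2 τ + τ N ≡ pow2 N - δ N
pow2-τ zero    = refl
pow2-τ (suc d) = begin
  + 1 * + 1 * Z + Σ< (suc d) h + Z
    ≡⟨ cong (λ s → + 1 * + 1 * Z + s + Z) (trans (Σ<-last d h) (cong₂ _+_ h-init h-last)) ⟩
  + 1 * + 1 * Z + (+ 2 * S + + 0) + Z
    ≡⟨ cong (λ z → + 1 * + 1 * z + (+ 2 * S + + 0) + z) (altFlagH-closed d 0) ⟩
  + 1 * + 1 * (+ (2 ^ d) - S) + (+ 2 * S + + 0) + (+ (2 ^ d) - S)
    ≡⟨ simplify (+ (2 ^ d)) S ⟩
  + 2 * + (2 ^ d) - + 0
    ≡⟨ cong (_- + 0) (sym (ℤᵖ.pos-* 2 (2 ^ d))) ⟩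
  pow2 (suc d) - δ (suc d) ∎
  where
  Z = altFlagH d 0
  S = Σ< d (λ i → + (2 ^ i) * + (suc (d ℕ.+ 0) C suc i) * τ (d ℕ.∸ i))
  h : Seq
  h i = + (suc d C suc i) * pow2 (suc i) * τ (d ℕ.∸ i)
  h-init : Σ< d h ≡ + 2 * S
  h-init = trans (φ-cong (Σ<-isLinear d) term) (φ-* (Σ<-isLinear d) (+ 2) _)
    where
    term : ∀ i → h i ≡ + 2 * (+ (2 ^ i) * + (suc (d ℕ.+ 0) C suc i) * τ (d ℕ.∸ i))
    term i = trans (cong₂ (λ c p → + c * p * τ (d ℕ.∸ i))
                          (cong (λ n → suc n C suc i) (sym (ℕᵖ.+-identityʳ d)))
                          (ℤᵖ.pos-* 2 (2 ^ i)))
                   (reassoc (+ (suc (d ℕ.+ 0) C suc i)) (+ 2) (+ (2 ^ i)) (τ (d ℕ.∸ i)))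
      where reassoc : ∀ c a b x → c * (a * b) * x ≡ a * (b * c * x)
            reassoc = solve-∀
  h-last : h d ≡ + 0
  h-last = trans (cong (λ k → + (suc d C suc d) * pow2 (suc d) * τ k) (ℕᵖ.n∸n≡0 d)) (ℤᵖ.*-zeroʳ (+ (suc d C suc d) * pow2 (suc d)))
  simplify : ∀ p s → + 1 * + 1 * (p - s) + (+ 2 * s + + 0) + (p - s) ≡ + 2 * p - + 0
  simplify = solve-∀

altSign : Seq
altSign zero    = + 1
altSign (suc k) = - altSign k

coshSeq sinhSeq : Seq
coshSeq zero          = + 1
coshSeq (suc zero)    = + 0
coshSeq (suc (suc k)) = coshSeq k
sinhSeq zero          = + 0
sinhSeq (suc zero)    = + 1
sinhSeq (suc (suc k)) = sinhSeq k

pow2⋆altSign : ∀ m → (pow2 ⋆ altSign) m ≡ + 1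
pow2⋆altSign zero    = refl
pow2⋆altSign (suc m) = begin
  ((λ k → pow2 (suc k)) ⋆ altSign) m + (pow2 ⋆ (λ k → altSign (suc k))) m
    ≡⟨ cong₂ _+_ (trans (φ-cong (⋆-isLinearˡ altSign m) (λ k → ℤᵖ.pos-* 2 (2 ^ k))) (φ-* (⋆-isLinearˡ altSign m) (+ 2) pow2))
                 (trans (φ-cong (⋆-isLinearʳ pow2 m) (λ k → sym (ℤᵖ.-1*i≡-i (altSign k)))) (φ-* (⋆-isLinearʳ pow2 m) (- + 1) altSign)) ⟩
  + 2 * (pow2 ⋆ altSign) m + - + 1 * (pow2 ⋆ altSign) m
    ≡⟨ cong₂ (λ x y → + 2 * x + - + 1 * y) (pow2⋆altSign m) (pow2⋆altSign m) ⟩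
  + 1 ∎

1+altSign : ∀ k → + 1 + altSign k ≡ + 2 * coshSeq k
1+altSign zero          = refl
1+altSign (suc zero)    = refl
1+altSign (suc (suc k)) = trans (cong (_+_ (+ 1)) (ℤᵖ.neg-involutive (altSign k))) (1+altSign k)

1-altSign : ∀ k → + 1 - altSign k ≡ + 2 * sinhSeq k
1-altSign zero          = refl
1-altSign (suc zero)    = refl
1-altSign (suc (suc k)) = trans (cong (_-_ (+ 1)) (ℤᵖ.neg-involutive (altSign k))) (1-altSign k)

-- Multiplying pow2-τ, i.e. (e^{2x} + 1) T(x) = e^{2x} - 1, by e^{-x} gives 2 cosh x · T(x) = 2 sinh x.
τ⋆cosh : ∀ N → (τ ⋆ coshSeq) N ≡ sinhSeq N
τ⋆cosh N = ℤᵖ.*-cancelˡ-≡ (+ 2) ((τ ⋆ coshSeq) N) (sinhSeq N) (begin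
  + 2 * (τ ⋆ coshSeq) N
    ≡⟨ sym (φ-* (⋆-isLinearʳ τ N) (+ 2) coshSeq) ⟩
  (τ ⋆ (λ k → + 2 * coshSeq k)) N
    ≡⟨ φ-cong (⋆-isLinearʳ τ N) (λ k → sym (1+altSign k)) ⟩
  (τ ⋆ (λ k → + 1 + altSign k)) N
    ≡⟨ φ-+ (⋆-isLinearʳ τ N) (λ _ → + 1) altSign ⟩
  (τ ⋆ (λ _ → + 1)) N + (τ ⋆ altSign) N
    ≡⟨ cong (_+ (τ ⋆ altSign) N) (sym τ⋆1) ⟩
  ((pow2 ⋆ τ) ⋆ altSign) N + (τ ⋆ altSign) N
    ≡⟨ sym (φ-+ (⋆-isLinearˡ altSign N) (pow2 ⋆ τ) τ) ⟩
  ((λ k → (pow2 ⋆ τ) k + τ k) ⋆ altSign) N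
    ≡⟨ φ-cong (⋆-isLinearˡ altSign N) (λ k → trans (cong (_+ τ k) (sym (binomialSum≡⋆ k pow2 τ))) (pow2-τ k)) ⟩
  ((λ k → pow2 k - δ k) ⋆ altSign) N
    ≡⟨ φ-− (⋆-isLinearˡ altSign N) pow2 δ ⟩
  (pow2 ⋆ altSign) N - (δ ⋆ altSign) N
    ≡⟨ cong₂ _-_ (pow2⋆altSign N) (δ-⋆ altSign N) ⟩
  + 1 - altSign N
    ≡⟨ 1-altSign N ⟩
  + 2 * sinhSeq N ∎)
  where
  τ⋆1 : ((pow2 ⋆ τ) ⋆ altSign) N ≡ (τ ⋆ (λ _ → + 1)) N
  τ⋆1 = begin
    ((pow2 ⋆ τ) ⋆ altSign) N   ≡⟨ φ-cong (⋆-isLinearˡ altSign N) (λ k → ⋆-comm pow2 τ k) ⟩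
    ((τ ⋆ pow2) ⋆ altSign) N   ≡⟨ ⋆-assoc τ pow2 altSign N ⟩
    (τ ⋆ (pow2 ⋆ altSign)) N   ≡⟨ φ-cong (⋆-isLinearʳ τ N) pow2⋆altSign ⟩
    (τ ⋆ (λ _ → + 1)) N        ∎

τ-recurrence : ∀ m → τ m ≡ sinhSeq m - Σ< m (λ k → + (m C k) * τ k * coshSeq (m ℕ.∸ k))
τ-recurrence m = x≡y+z⇒z≡x-y (begin
  sinhSeq m
    ≡⟨ sym (trans (binomialSum≡⋆ m τ coshSeq) (τ⋆cosh m)) ⟩
  binomialSum m τ coshSeq
    ≡⟨ Σ<-last m (λ k → + (m C k) * τ k * coshSeq (m ℕ.∸ k)) ⟩
  S + + (m C m) * τ m * coshSeq (m ℕ.∸ m)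
    ≡⟨ cong₂ (λ c j → S + + c * τ m * coshSeq j) (nCn≡1 m) (ℕᵖ.n∸n≡0 m) ⟩
  S + + 1 * τ m * + 1
    ≡⟨ cong (_+_ S) (trans (ℤᵖ.*-identityʳ (+ 1 * τ m)) (ℤᵖ.*-identityˡ (τ m))) ⟩
  S + τ m ∎)
  where S = Σ< m (λ k → + (m C k) * τ k * coshSeq (m ℕ.∸ k))

length-eulers : ∀ m → length (eulers m) ≡ m
length-eulers zero    = refl
length-eulers (suc m) = trans (length-++ (eulers m)) (trans (ℕᵖ.+-comm (length (eulers m)) 1) (cong suc (length-eulers m)))

nth-++ : ∀ (xs ys : List ℤ) k → k < length xs → nth (xs ++ ys) k ≡ nth xs k
nth-++ (x ∷ xs) ys zero    _         = refl
nth-++ (x ∷ xs) ys (suc k) (s≤s k<n) = nth-++ xs ys k k<n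

nth-∷ʳ : ∀ (xs : List ℤ) x → nth (xs ++ x ∷ []) (length xs) ≡ x
nth-∷ʳ []       x = refl
nth-∷ʳ (y ∷ xs) x = nth-∷ʳ xs x

nth-eulers : ∀ m k → k < m → nth (eulers m) k ≡ euler k
nth-eulers (suc m) k k<1+m with ℕᵖ.m<1+n⇒m<n∨m≡n k<1+m
... | inj₁ k<m  = trans (nth-++ (eulers m) _ k (subst (k <_) (sym (length-eulers m)) k<m)) (nth-eulers m k k<m)
... | inj₂ refl = refl

euler-recurrence : ∀ m → euler m ≡ onePlusSin m - Σ< m (λ k → + (m C k) * euler k * cosc (m ℕ.∸ k))
euler-recurrence m = begin
  nth (eulers m ++ next ∷ []) m                ≡⟨ cong (nth (eulers m ++ next ∷ [])) (sym (length-eulers m)) ⟩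
  nth (eulers m ++ next ∷ []) (length (eulers m)) ≡⟨ nth-∷ʳ (eulers m) next ⟩
  next                                          ≡⟨ cong (_-_ (onePlusSin m)) (trans (cong sumℤ (map-upTo _ m)) (Σ<-cong< m known)) ⟩
  onePlusSin m - Σ< m (λ k → + (m C k) * euler k * cosc (m ℕ.∸ k)) ∎
  where
  next = onePlusSin m - sumℤ (map (λ k → + (m C k) * nth (eulers m) k * cosc (m ℕ.∸ k)) (upTo m))
  known : ∀ k → k < m → + (m C k) * nth (eulers m) k * cosc (m ℕ.∸ k) ≡ + (m C k) * euler k * cosc (m ℕ.∸ k)
  known k k<m = cong (λ e → + (m C k) * e * cosc (m ℕ.∸ k)) (nth-eulers m k k<m)

odd : ℕ → Bool
odd zero    = false
odd (suc k) = not (odd k)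

odd-+ : ∀ k j → odd (k ℕ.+ j) ≡ odd k xor odd j
odd-+ zero    j = refl
odd-+ (suc k) j = trans (cong not (odd-+ k j)) (not-distribˡ-xor (odd k) (odd j))

-- The signs by which the Taylor coefficients of cos x = cosh(ix) and sin x = -i sinh(ix)
-- differ from those of cosh and sinh.
wick : Seq
wick zero          = + 1
wick (suc zero)    = + 1
wick (suc (suc k)) = - wick k

wick-+ : ∀ k j → odd j ≡ false → wick (k ℕ.+ j) ≡ wick k * wick j
wick-+ k zero          _    = trans (cong wick (ℕᵖ.+-identityʳ k)) (sym (ℤᵖ.*-identityʳ (wick k)))
wick-+ k (suc (suc j)) even = begin
  wick (k ℕ.+ suc (suc j))   ≡⟨ cong wick (trans (ℕᵖ.+-suc k (suc j)) (cong suc (ℕᵖ.+-suc k j))) ⟩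
  - wick (k ℕ.+ j)           ≡⟨ cong -_ (wick-+ k j (trans (sym (not-involutive (odd j))) even)) ⟩
  - (wick k * wick j)        ≡⟨ ℤᵖ.neg-distribʳ-* (wick k) (wick j) ⟩
  wick k * - wick j          ∎

cosc≡wick*cosh : ∀ j → cosc j ≡ wick j * coshSeq j
cosc≡wick*cosh zero          = refl
cosc≡wick*cosh (suc zero)    = refl
cosc≡wick*cosh (suc (suc j)) = trans (cong -_ (cosc≡wick*cosh j)) (ℤᵖ.neg-distribˡ-* (wick j) (coshSeq j))

sinc≡wick*sinh : ∀ j → sinc j ≡ wick j * sinhSeq j
sinc≡wick*sinh zero          = refl
sinc≡wick*sinh (suc zero)    = refl
sinc≡wick*sinh (suc (suc j)) = trans (cong -_ (sinc≡wick*sinh j)) (ℤᵖ.neg-distribˡ-* (wick j) (sinhSeq j))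

coshSeq-odd : ∀ j → odd j ≡ true → coshSeq j ≡ + 0
coshSeq-odd (suc zero)    _   = refl
coshSeq-odd (suc (suc j)) odd-j = coshSeq-odd j (trans (sym (not-involutive (odd j))) odd-j)

-- The terms with m - k odd vanish on both sides, and in the others k is odd.
euler-term : ∀ m k → k < m → odd m ≡ true → (odd k ≡ true → euler k ≡ wick k * τ k) →
             + (m C k) * euler k * cosc (m ℕ.∸ k) ≡ wick m * (+ (m C k) * τ k * coshSeq (m ℕ.∸ k))
euler-term m k k<m odd-m ih with odd (m ℕ.∸ k) in odd-j
... | true = begin
  + (m C k) * euler k * cosc j                       ≡⟨ cong (+ (m C k) * euler k *_) (cosc≡wick*cosh j) ⟩
  + (m C k) * euler k * (wick j * coshSeq j)         ≡⟨ cong (λ c → + (m C k) * euler k * (wick j * c)) cosh-j ⟩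
  + (m C k) * euler k * (wick j * + 0)               ≡⟨ vanish (+ (m C k)) (euler k) (wick j) (wick m) (τ k) ⟩
  wick m * (+ (m C k) * τ k * + 0)                   ≡⟨ cong (λ c → wick m * (+ (m C k) * τ k * c)) (sym cosh-j) ⟩
  wick m * (+ (m C k) * τ k * coshSeq j)             ∎
  where j = m ℕ.∸ k
        cosh-j = coshSeq-odd j odd-j
        vanish : ∀ c e w W t → c * e * (w * + 0) ≡ W * (c * t * + 0)
        vanish = solve-∀
... | false = begin
  + (m C k) * euler k * cosc j                       ≡⟨ cong₂ (λ e x → + (m C k) * e * x) (ih odd-k) (cosc≡wick*cosh j) ⟩
  + (m C k) * (wick k * τ k) * (wick j * coshSeq j)  ≡⟨ reassoc (+ (m C k)) (wick k) (τ k) (wick j) (coshSeq j) ⟩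
  wick k * wick j * (+ (m C k) * τ k * coshSeq j)    ≡⟨ cong (_* (+ (m C k) * τ k * coshSeq j)) (sym wick-m) ⟩
  wick m * (+ (m C k) * τ k * coshSeq j)             ∎
  where j = m ℕ.∸ k
        m≡k+j : k ℕ.+ j ≡ m
        m≡k+j = ℕᵖ.m+[n∸m]≡n (ℕᵖ.<⇒≤ k<m)
        odd-k : odd k ≡ true
        odd-k = trans (sym (trans (cong (odd k xor_) odd-j) (xor-falseʳ (odd k)))) (trans (sym (odd-+ k j)) (trans (cong odd m≡k+j) odd-m))
          where xor-falseʳ : ∀ b → b xor false ≡ b
                xor-falseʳ true  = refl
                xor-falseʳ false = refl
        wick-m : wick m ≡ wick k * wick j
        wick-m = trans (cong wick (sym m≡k+j)) (wick-+ k j odd-j)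
        reassoc : ∀ c w t v h → c * (w * t) * (v * h) ≡ w * v * (c * t * h)
        reassoc = solve-∀

euler-odd : ∀ m → odd m ≡ true → euler m ≡ wick m * τ m
euler-odd = <-rec _ λ m rec odd-m → begin
  euler m
    ≡⟨ euler-recurrence m ⟩
  onePlusSin m - Σ< m (λ k → + (m C k) * euler k * cosc (m ℕ.∸ k))
    ≡⟨ cong₂ _-_ (onePlusSin-odd m odd-m) (Σ<-cong< m (λ k k<m → euler-term m k k<m odd-m (rec k<m))) ⟩
  wick m * sinhSeq m - Σ< m (λ k → wick m * (+ (m C k) * τ k * coshSeq (m ℕ.∸ k)))
    ≡⟨ cong (_-_ (wick m * sinhSeq m)) (φ-* (Σ<-isLinear m) (wick m) _) ⟩
  wick m * sinhSeq m - wick m * Σ< m (λ k → + (m C k) * τ k * coshSeq (m ℕ.∸ k))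
    ≡⟨ factor (wick m) (sinhSeq m) (Σ< m (λ k → + (m C k) * τ k * coshSeq (m ℕ.∸ k))) ⟩
  wick m * (sinhSeq m - Σ< m (λ k → + (m C k) * τ k * coshSeq (m ℕ.∸ k)))
    ≡⟨ cong (wick m *_) (sym (τ-recurrence m)) ⟩
  wick m * τ m ∎
  where onePlusSin-odd : ∀ m → odd m ≡ true → onePlusSin m ≡ wick m * sinhSeq m
        onePlusSin-odd (suc m) _ = sinc≡wick*sinh (suc m)
        factor : ∀ w s t → w * s - w * t ≡ w * (s - t)
        factor = solve-∀

wick*[-2]^n : ∀ n → wick (suc (double n)) * (- + 2) ℤ.^ n ≡ + (2 ^ n)
wick*[-2]^n zero    = refl
wick*[-2]^n (suc n) = begin
  - wick (suc (double n)) * (- + 2 * (- + 2) ℤ.^ n) ≡⟨ sign-cancel (wick (suc (double n))) ((- + 2) ℤ.^ n) ⟩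
  + 2 * (wick (suc (double n)) * (- + 2) ℤ.^ n)      ≡⟨ cong (+ 2 *_) (wick*[-2]^n n) ⟩
  + 2 * + (2 ^ n)                                   ≡⟨ sym (ℤᵖ.pos-* 2 (2 ^ n)) ⟩
  + (2 ^ suc n)                                     ∎
  where sign-cancel : ∀ w p → - w * (- + 2 * p) ≡ + 2 * (w * p)
        sign-cancel = solve-∀

odd-suc-double : ∀ n → odd (suc (double n)) ≡ true
odd-suc-double zero    = refl
odd-suc-double (suc n) = trans (not-involutive (odd (suc (double n)))) (odd-suc-double n)

lemma5p2 : (n : ℕ) →
    Σ (CDWord (double n) → ℤ) (λ ψ → IsCDIndexB (double n) ψ)
    × ((ψ : CDWord (double n) → ℤ) → IsCDIndexB (double n) ψ →
    (+ (2 ^ n)) * ψ (dPow n) ≡ euler (suc (double n)))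
lemma5p2 n = (cdIndex (double n) , cdIndex-isCDIndexB (double n)) , λ ψ isΨ → begin
  + (2 ^ n) * ψ (dPow n)                      ≡⟨ cong (_* ψ (dPow n)) (sym (wick*[-2]^n n)) ⟩
  wick m * (- + 2) ℤ.^ n * ψ (dPow n)         ≡⟨ ℤᵖ.*-assoc (wick m) _ _ ⟩
  wick m * ((- + 2) ℤ.^ n * ψ (dPow n))       ≡⟨ cong (wick m *_) (cdIndex-dPow n ψ isΨ) ⟩
  wick m * τ m                                ≡⟨ sym (euler-odd m (odd-suc-double n)) ⟩
  euler m                                     ∎
  where m = suc (double n)
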